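{- For each ordered normal set automaton $\mathcal{A}$ over alphabet $\Sigma$, one can construct an ordered multicounter automaton $\mathcal{M}$ over $\Sigma$ whose language is the string projection $\{\mathrm{str}(w)\mid w\in L(\mathcal{A})\}$ of $L(\mathcal{A})$, where $\mathrm{str}((a_1,d_1)\cdots(a_n,d_n))=a_1\cdots a_n$.
   Context: Fix an infinite set $\mathcal{D}$ of data values; data words over $\Sigma$ are finite sequences in $(\Sigma\times\mathcal{D})^*$. For a finite set $Y$, $\mathbbm{2}^Y$ is the set of $\{0,1\}$-vectors indexed by $Y$, $e_y$ the unit vector, $\bar 0$ the zero vector; $\mathbf{R}_Y$ the set of binary relations on $Y$; for $\rho\in\mathbf{R}_Y$, $\bar z\in\mathbbm{2}^Y$, $\rho[\bar z]$ has $y$-entry $1$ iff some $x$ has $z_x=1$ and $(x,y)\in\rho$. A set automaton $\mathcal{A}=(Q,Y,\Sigma,\Delta,I,F,C)$ has finite states $Q$, finite set names $Y$, transitions $\Delta\subseteq Q\times\Sigma\times\mathbbm{2}^Y\times\mathbf{R}_Y\times\mathbbm{2}^Y\times\mathbbm{2}^Y\times Q$, $I,F\subseteq Q$, $C\subseteq\mathbbm{2}^Y$. Configurations are $(q,(X_y)_{y\in Y})$, $X_y\subseteq\mathcal{D}$; initial if $q\in I$ and all $X_y=\emptyset$. On input $(a,d)$, transition $(p,\ell,\bar z,\rho,\bar u,\bar v,p')$ applies iff $p=q$, $\ell=a$, $\bar z$ is the characteristic vector of $d$; the result is $(p',\bar X'')$ with $X'_y=\bigcup_{(x,y)\in\rho}X_x$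 and $X''_y=(X'_y\cup U_y)\setminus V_y$, $U_y=\{d\}$ iff $u_y=1$ (else $\emptyset$), $V_y=\{d\}$ iff $v_y=1$ (else $\emptyset$). Accepting configuration: $q\in F$ and every data value present in some $X_y$ has characteristic vector in $C$. $L(\mathcal{A})$: data words with a run from an initial to an accepting configuration. Normal: every transition has $\rho$ a function $Y\to Y$, $\bar u$ a unit vector, and $\bar v=\rho[\bar z]$ if $\bar u\neq\rho[\bar z]$, else $\bar 0$. With $\rho^+$ the transitive closure of the union of all global updates used, $y$ is bounded if no $z$ with $(z,z)\in\rho^+$ satisfies $z=y$ or $(z,y)\in\rho^+$. A normal set automaton with bounded sets $Z$ is ordered if there is a linear order $\le$ on $Y$ with $Y\setminus Z$ entirely below $Z$, such that for each global update $\rho$ used there is a partition $Y\setminus Z=Y_0\uplus Y_1$ with $Y_0$ entirely below $Y_1$, $\rho(Y_0)\subseteq Y_1$ and $\rho$ the identity on $Y_1$. An ordered multicounter automaton is $(Q,\Sigma,O,\Delta,J,F)$ with finite states $Q$, initial states $J$, final states $F$, linearly ordered counters $O=\{c_1,\dots,c_k\}$ ranging over $\mathbb{N}$, and transitions $\Delta\subseteq Q\times(\Sigma\cup\{\varepsilon\})\times\{I_i,D_i,Z_{\le i}\mid i\in[k]\}\times Q$, where $I_i$ increments $c_i$, $D_i$ decrements $c_i$ (blocked if $c_i=0$), and $Z_{\le i}$ is enabled only if $c_1=\cdots=c_i=0$. A word is accepted if there is a run reading it from an initial state with all counters $0$ to a final state with all counters $0$. -}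

module Defs where

open import Level using (0ℓ)
open import Data.Nat using (ℕ; zero; suc; _≟_)
open import Data.Fin as Fin using (Fin; toℕ)
open import Data.Fin.Properties as FinP using ()
open import Data.Bool using (Bool; true; false; _∧_; _∨_; not; if_then_else_)
open import Data.List using (List; []; _∷_; map)
open import Data.List.Membership.Propositional using (_∈_)
open import Data.Maybe using (Maybe; just; nothing)
open import Data.Product using (Σ; ∃; _×_; _,_; proj₁)
open import Data.Sum using (_⊎_)
open import Data.Vec.Functional using (updateAt)
open import Relation.Binary.PropositionalEquality using (_≡_)
open import Relation.Binary.Structures using (IsTotalOrder)
open import Relation.Nullary using (¬_; does)

-- Conventions
--  * The infinite data domain 𝒟 is fixed to be ℕ.
--  * The finite alphabet Σ is Fin s.
--  * The finite sets Q (states) and Y (set names) are Fin nq and Fin ny.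
--  * 𝟚^Y is represented as Fin ny → Bool, compared pointwise.
--  * A binary relation on Y is Fin ny → Fin ny → Bool.
--  * The sets X_y ⊆ 𝒟 are decidable subsets ℕ → Bool.

Vec𝟚 : ℕ → Set
Vec𝟚 n = Fin n → Bool

Rel𝟚 : ℕ → Set
Rel𝟚 n = Fin n → Fin n → Bool

_≐_ : ∀ {n} → Vec𝟚 n → Vec𝟚 n → Set
u ≐ v = ∀ y → u y ≡ v y

anyFin : ∀ {n} → (Fin n → Bool) → Bool
anyFin {zero}  f = false
anyFin {suc n} f = f Fin.zero ∨ anyFin {n} (λ i → f (Fin.suc i))

zeroVec : ∀ {n} → Vec𝟚 n
zeroVec _ = false

_[_]ᵣ : ∀ {n} → Rel𝟚 n → Vec𝟚 n → Vec𝟚 n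
(ρ [ z ]ᵣ) y = anyFin (λ x → z x ∧ ρ x y)

DataWord : ℕ → Set
DataWord s = List (Fin s × ℕ)

str : ∀ {s} → DataWord s → List (Fin s)
str = map proj₁

record SATrans (nq ny s : ℕ) : Set where
  constructor mkTr
  field
    src : Fin nq
    lab : Fin s
    zv  : Vec𝟚 ny
    ρ   : Rel𝟚 ny
    uv  : Vec𝟚 ny
    vv  : Vec𝟚 ny
    tgt : Fin nq

record SetAutomaton (s : ℕ) : Set where
  field
    nq ny : ℕ
    Δ     : List (SATrans nq ny s)
    I F   : Fin nq → Bool
    C     : List (Vec𝟚 ny)

module _ {s : ℕ} (A : SetAutomaton s) where
  open SetAutomaton A
  open SATrans

  SAConfig : Set
  SAConfig = Fin nq × (Fin ny → ℕ → Bool)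

  charVec : (Fin ny → ℕ → Bool) → ℕ → Vec𝟚 ny
  charVec X d y = X y d

  Applicable : SATrans nq ny s → SAConfig → Fin s × ℕ → Set
  Applicable t (q , X) (a , d) = src t ≡ q × lab t ≡ a × (zv t ≐ charVec X d)

  applyTr : SATrans nq ny s → SAConfig → ℕ → SAConfig
  applyTr t (q , X) d =
    tgt t , λ y e →
      ((anyFin (λ x → ρ t x y ∧ X x e)) ∨ (uv t y ∧ does (e ≟ d)))
      ∧ not (vv t y ∧ does (e ≟ d))

  _∈C : Vec𝟚 ny → Set
  v ∈C = Σ (Vec𝟚 ny) λ c → c ∈ C × c ≐ v

  IsAccepting : SAConfig → Set
  IsAccepting (q , X) =
    F q ≡ true × (∀ e → (Σ (Fin ny) λ y → X y e ≡ true) → charVec X e ∈C)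

  data AccRun : SAConfig → DataWord s → Set where
    done : ∀ {c} → IsAccepting c → AccRun c []
    step : ∀ {c a d w} (t : SATrans nq ny s) → t ∈ Δ → Applicable t c (a , d) →
           AccRun (applyTr t c d) w → AccRun c ((a , d) ∷ w)

  emptySets : Fin ny → ℕ → Bool
  emptySets _ _ = false

  InL : DataWord s → Set
  InL w = Σ (Fin nq) λ q → I q ≡ true × AccRun (q , emptySets) w

  IsFunctionRel : Rel𝟚 ny → Set
  IsFunctionRel ρ = Σ (Fin ny → Fin ny) λ f → ∀ x y → (ρ x y ≡ true → f x ≡ y) × (f x ≡ y → ρ x y ≡ true)

  IsUnit : Vec𝟚 ny → Set
  IsUnit u = Σ (Fin ny) λ y₀ → ∀ y → (u y ≡ true → y ≡ y₀) × (y ≡ y₀ → u y ≡ true)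

  NormalTrans : SATrans nq ny s → Set
  NormalTrans t =
    IsFunctionRel (ρ t) × IsUnit (uv t) ×
    ((¬ (uv t ≐ (ρ t [ zv t ]ᵣ)) → vv t ≐ (ρ t [ zv t ]ᵣ)) ×
     ((uv t ≐ (ρ t [ zv t ]ᵣ)) → vv t ≐ zeroVec))

  Normal : Set
  Normal = ∀ t → t ∈ Δ → NormalTrans t

  data Plus : Fin ny → Fin ny → Set where
    base : ∀ {x y} (t : SATrans nq ny s) → t ∈ Δ → ρ t x y ≡ true → Plus x y
    trans : ∀ {x y z} → Plus x y → Plus y z → Plus x z

  Bounded : Fin ny → Set
  Bounded y = ∀ z → Plus z z → ¬ (z ≡ y ⊎ Plus z y)

  record Ordered : Set₁ where
    field
      _≼_     : Fin ny → Fin ny → Set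
      isTotal : IsTotalOrder _≡_ _≼_
      unboundedBelow : ∀ x y → ¬ Bounded x → Bounded y → x ≼ y
      partition :
        ∀ t → t ∈ Δ →
        Σ (Vec𝟚 ny) λ Y₀ → Σ (Vec𝟚 ny) λ Y₁ →
          (∀ y → (¬ Bounded y → (Y₀ y ≡ true ⊎ Y₁ y ≡ true))
               × ((Y₀ y ≡ true ⊎ Y₁ y ≡ true) → ¬ Bounded y)
               × ¬ (Y₀ y ≡ true × Y₁ y ≡ true))
          × (∀ x y → Y₀ x ≡ true → Y₁ y ≡ true → x ≼ y)
          × (∀ x y → Y₀ x ≡ true → ρ t x y ≡ true → Y₁ y ≡ true)
          × (∀ x y → Y₁ x ≡ true → (ρ t x y ≡ true → y ≡ x) × (y ≡ x → ρ t x y ≡ true))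

-- Ordered multicounter automata (counters c₁ < … < c_k are Fin k, index
-- i : Fin k stands for counter c_{toℕ i + 1})

data CounterOp (k : ℕ) : Set where
  incr  : Fin k → CounterOp k
  decr  : Fin k → CounterOp k
  zeroTest : Fin k → CounterOp k

record MCTrans (nq s k : ℕ) : Set where
  constructor mkMCTr
  field
    src : Fin nq
    lab : Maybe (Fin s)   -- nothing = ε
    op  : CounterOp k
    tgt : Fin nq

record MulticounterAutomaton (s : ℕ) : Set where
  field
    nq k : ℕ
    Δ    : List (MCTrans nq s k)
    J F  : Fin nq → Bool

Counters : ℕ → Set
Counters k = Fin k → ℕ

data OpStep {k : ℕ} : CounterOp k → Counters k → Counters k → Set where
  doIncr : ∀ {c} i → OpStep (incr i) c (updateAt c i suc)
  doDecr : ∀ {c} i m → c i ≡ suc m → OpStep (decr i) c (updateAt c i (λ _ → m))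
  doZero : ∀ {c} i → (∀ j → toℕ j Data.Nat.≤ toℕ i → c j ≡ 0) → OpStep (zeroTest i) c c

module _ {s : ℕ} (M : MulticounterAutomaton s) where
  open MulticounterAutomaton M
  open MCTrans

  MCConfig : Set
  MCConfig = Fin nq × Counters k

  data MCAccRun : MCConfig → List (Fin s) → Set where
    done  : ∀ {q c} → F q ≡ true → (∀ i → c i ≡ 0) → MCAccRun (q , c) []
    stepε : ∀ {q c c' w} (t : MCTrans nq s k) → t ∈ Δ → src t ≡ q → lab t ≡ nothing →
            OpStep (op t) c c' → MCAccRun (tgt t , c') w → MCAccRun (q , c) w
    stepa : ∀ {q c c' a w} (t : MCTrans nq s k) → t ∈ Δ → src t ≡ q → lab t ≡ just a →
            OpStep (op t) c c' → MCAccRun (tgt t , c') w → MCAccRun (q , c) (a ∷ w)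

  InLMC : List (Fin s) → Set
  InLMC w = Σ (Fin nq) λ q → J q ≡ true × MCAccRun (q , (λ _ → 0)) w

module Submission where

open import Defs renaming (trans to ⁺-trans)
open import Data.Nat using (ℕ)
open import Data.Fin using (Fin)
open import Data.List using (List)
open import Data.Product using (Σ; _×_)
open import Relation.Binary.PropositionalEquality using (_≡_)

import Data.Bool as Bool
open import Data.Bool using (Bool; true; false; _∧_; _∨_; not; if_then_else_)
open import Data.Bool.Properties using (¬-not; ∧-conicalˡ; ∧-conicalʳ; ∨-zeroʳ; ∧-zeroʳ; ∧-identityʳ; ∨-identityʳ; ∨-idem; ∧-comm)
open import Data.Empty using (⊥; ⊥-elim)
open import Data.Fin as Fin using (zero; suc; toℕ)
import Data.Fin.Properties as Fin
open import Data.List using ([]; _∷_; _++_; [_]; map; length; lookup; allFin; filter; foldr; cartesianProduct)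
open import Data.List.Properties using (length-tabulate; filter-all; filter-accept; filter-reject; ++-assoc; ++-identityʳ)
open import Data.List.Membership.Propositional using (_∈_; _∉_; find; lose)
open import Data.List.Membership.Propositional.Properties
  using (∈-allFin; ∈-lookup; ∈-filter⁺; ∈-filter⁻; ∈-map⁺; ∈-map⁻; ∈-++⁺ˡ; ∈-++⁺ʳ; ∈-cartesianProduct⁺; ∈-∃++)
open import Data.List.Relation.Unary.All as All using (All; []; _∷_)
import Data.List.Relation.Unary.All.Properties as AllP
open import Data.List.Relation.Unary.AllPairs using (AllPairs; []; _∷_)
import Data.List.Relation.Unary.AllPairs.Properties as AllPairs
open import Data.List.Relation.Unary.Any as Any using (here; there)
open import Data.List.Relation.Unary.Any.Properties using (lookup-index)
open import Data.Maybe using (Maybe; just; nothing)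
import Data.Maybe.Properties as Maybe
import Data.Nat as ℕ
open import Data.Nat using (zero; suc; _+_; _∸_; _⊔_; _≤_; _<_; z≤n; s≤s)
open import Data.Nat.Properties
open import Data.Nat.Solver using (module +-*-Solver)
open +-*-Solver using (solve; _:+_; _:=_)
open import Data.Product using (_,_; proj₁; proj₂)
open import Data.Product.Properties using (≡-dec)
open import Data.Sum using (_⊎_; inj₁; inj₂; [_,_]′)
open import Data.Unit using (tt)
open import Data.Vec as Vec using (Vec)
import Data.Vec.Properties as Vec
open import Data.Vec.Functional using (updateAt)
open import Data.Vec.Functional.Properties using (updateAt-updates; updateAt-minimal)
open import Function using (_∘_; id; _on_; mk⇔)
open import Relation.Binary.Definitions using (DecidableEquality)
open import Relation.Binary.PropositionalEquality using (_≢_; refl; sym; trans; cong; cong₂; subst; module ≡-Reasoning)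
open import Relation.Binary.Structures using (IsTotalOrder)
open import Relation.Nullary using (¬_; Dec; yes; no; does)
open import Relation.Nullary.Decidable using (dec-true; dec-false; does-⇔; map′; _×-dec_; _⊎-dec_; _→-dec_; ¬?)

-- In a normal set automaton every datum lies in at most one set, so a configuration is a list of
-- (datum, set) pairs, and the multicounter automaton M only keeps the sizes of the sets. Unbounded
-- sets are kept in counters, numbered along the linear order of the set names; bounded sets are kept
-- in the finite control, which is possible because a datum in a bounded set y was inserted k steps
-- earlier and then moved along a path of length k ending in y, and such paths are shorter than |Y|:
-- as one datum is inserted per step, y never holds more than |Y| data.
-- A global update moves Y₀ into Y₁ and fixes Y₁. M simulates it by moving the data of the Y₀
-- counters one at a time; as Y₀ is an initial segment of the counters, the zero test Z_{≤|Y₀|}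
-- certifies that all of them have been moved. A run of M is turned back into a data word by reading,
-- at each step, a datum of the guessed set, or a fresh datum when M guesses that it is in no set.

bit : Bool → ℕ
bit true  = 1
bit false = 0

bit-mono : ∀ {a b} → (a ≡ true → b ≡ true) → bit a ≤ bit b
bit-mono {false} _ = z≤n
bit-mono {true}  h rewrite h refl = ≤-refl

bool-ext : ∀ {a b} → (a ≡ true → b ≡ true) → (b ≡ true → a ≡ true) → a ≡ b
bool-ext {false} {false} _ _ = refl
bool-ext {false} {true}  _ g = g refl
bool-ext {true}  {false} f _ = sym (f refl)
bool-ext {true}  {true}  _ _ = refl

∨-true : ∀ {a b} → a ∨ b ≡ true → a ≡ true ⊎ b ≡ true
∨-true {true}  _ = inj₁ refl
∨-true {false} h = inj₂ h

∧-true : ∀ {a b} → a ≡ true → b ≡ true → a ∧ b ≡ true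
∧-true refl refl = refl

true≢false : true ≢ false
true≢false ()

not≡true : ∀ {b} → not b ≡ true → b ≡ false
not≡true {false} _ = refl

from-does : ∀ {P : Set} (P? : Dec P) → does P? ≡ true → P
from-does (yes p) _ = p

does-≟-sym : ∀ {n} (x y : Fin n) → does (x Fin.≟ y) ≡ does (y Fin.≟ x)
does-≟-sym x y = does-⇔ (mk⇔ sym sym) (x Fin.≟ y) (y Fin.≟ x)

suc-of : ∀ {n} → 1 ≤ n → Σ ℕ λ m → n ≡ suc m
suc-of {suc m} _ = m , refl

count : ∀ {A : Set} → (A → Bool) → List A → ℕ
count p []       = 0
count p (x ∷ xs) = bit (p x) + count p xs

module _ {A : Set} where

  count-++ : ∀ (p : A → Bool) xs ys → count p (xs ++ ys) ≡ count p xs + count p ys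
  count-++ p []       ys = refl
  count-++ p (x ∷ xs) ys = trans (cong (bit (p x) +_) (count-++ p xs ys)) (sym (+-assoc (bit (p x)) _ _))

  count-map : ∀ {B : Set} (p : B → Bool) (g : A → B) xs → count p (map g xs) ≡ count (p ∘ g) xs
  count-map p g []       = refl
  count-map p g (x ∷ xs) = cong (bit (p (g x)) +_) (count-map p g xs)

  count-cong : ∀ {p q : A → Bool} {xs} → All (λ x → p x ≡ q x) xs → count p xs ≡ count q xs
  count-cong []       = refl
  count-cong (e ∷ es) = cong₂ _+_ (cong bit e) (count-cong es)

  count-mono : ∀ {p q : A → Bool} {xs} → All (λ x → p x ≡ true → q x ≡ true) xs → count p xs ≤ count q xs
  count-mono []       = z≤n
  count-mono (e ∷ es) = +-mono-≤ (bit-mono e) (count-mono es)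

  count-strict : ∀ {p q : A → Bool} {xs x} → All (λ x → p x ≡ true → q x ≡ true) xs →
    x ∈ xs → q x ≡ true → p x ≡ false → count p xs < count q xs
  count-strict (_ ∷ es) (here refl) qx px rewrite qx | px = s≤s (count-mono es)
  count-strict (e ∷ es) (there x∈) qx px = +-mono-≤-< (bit-mono e) (count-strict es x∈ qx px)

  count-allFalse : ∀ {p : A → Bool} {xs} → All (λ x → p x ≡ false) xs → count p xs ≡ 0
  count-allFalse []          = refl
  count-allFalse (px ∷ pxs) rewrite px = count-allFalse pxs

  count≤length : ∀ (p : A → Bool) xs → count p xs ≤ length xs
  count≤length p []       = z≤n
  count≤length p (x ∷ xs) with p x
  ... | true  = s≤s (count≤length p xs)
  ... | false = m≤n⇒m≤1+n (count≤length p xs)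

  count<length : ∀ (p : A → Bool) {xs x} → x ∈ xs → p x ≡ false → count p xs < length xs
  count<length p {x ∷ xs} (here refl) px rewrite px = s≤s (count≤length p xs)
  count<length p {y ∷ xs} (there x∈) px with p y
  ... | true  = s≤s (count<length p x∈ px)
  ... | false = m≤n⇒m≤1+n (count<length p x∈ px)

  count-∈ : ∀ (p : A → Bool) {x xs} → x ∈ xs → p x ≡ true → 1 ≤ count p xs
  count-∈ p (here refl) px rewrite px = s≤s z≤n
  count-∈ p {xs = y ∷ _} (there x∈) px = ≤-trans (count-∈ p x∈ px) (m≤n+m _ (bit (p y)))

  count-witness : ∀ (p : A → Bool) xs → 1 ≤ count p xs → Σ A λ x → x ∈ xs × p x ≡ true
  count-witness p (x ∷ xs) h with p x in px
  ... | true  = x , here refl , px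
  ... | false = let (y , y∈ , py) = count-witness p xs h in y , there y∈ , py

  -- both sides are moved so that no subtraction occurs
  count-replace : ∀ (p : A → Bool) pre a a′ post →
    count p (pre ++ a ∷ post) + bit (p a′) ≡ count p (pre ++ a′ ∷ post) + bit (p a)
  count-replace p pre a a′ post rewrite count-++ p pre (a ∷ post) | count-++ p pre (a′ ∷ post) =
    solve 4 (λ c x y z → (c :+ (x :+ y)) :+ z := (c :+ (z :+ y)) :+ x) refl
      (count p pre) (bit (p a)) (count p post) (bit (p a′))

  count-replace-≡ : ∀ (p : A → Bool) pre a a′ post {v v′} → v ≡ count p (pre ++ a ∷ post) →
    v′ + bit (p a) ≡ v + bit (p a′) → v′ ≡ count p (pre ++ a′ ∷ post)
  count-replace-≡ p pre a a′ post {v} {v′} v≡ h =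
    +-cancelʳ-≡ (bit (p a)) v′ _ (trans h (trans (cong (_+ bit (p a′)) v≡) (count-replace p pre a a′ post)))

  All-replace : ∀ {P : A → Set} pre {a a′} post → All P (pre ++ a ∷ post) → P a′ → All P (pre ++ a′ ∷ post)
  All-replace pre post all pa′ with AllP.++⁻ pre all
  ... | all-pre , (_ ∷ all-post) = AllP.++⁺ all-pre (pa′ ∷ all-post)

  map-replace : ∀ {B : Set} (g : A → B) pre {a a′} post → g a ≡ g a′ → map g (pre ++ a ∷ post) ≡ map g (pre ++ a′ ∷ post)
  map-replace g []        post ga≡ga′ = cong (_∷ map g post) ga≡ga′
  map-replace g (x ∷ pre) post ga≡ga′ = cong (g x ∷_) (map-replace g pre post ga≡ga′)

  count-filter≤ : ∀ (p : A → Bool) {P : A → Set} (P? : ∀ x → Dec (P x)) xs → count p (filter P? xs) ≤ count p xs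
  count-filter≤ p P? []       = z≤n
  count-filter≤ p P? (x ∷ xs) with does (P? x)
  ... | true  = +-monoʳ-≤ (bit (p x)) (count-filter≤ p P? xs)
  ... | false = ≤-trans (count-filter≤ p P? xs) (m≤n+m _ (bit (p x)))

countFin : ∀ {n} → (Fin n → Bool) → ℕ
countFin p = count p (allFin _)

countFin≤n : ∀ {n} (p : Fin n → Bool) → countFin p ≤ n
countFin≤n p = subst (countFin p ≤_) (length-tabulate id) (count≤length p (allFin _))

countFin<n : ∀ {n} (p : Fin n → Bool) i → p i ≡ false → countFin p < n
countFin<n {n} p i pi = subst (countFin p <_) (length-tabulate id) (count<length p (∈-allFin i) pi)

countFin-mono : ∀ {n} {p q : Fin n → Bool} → (∀ i → p i ≡ true → q i ≡ true) → countFin p ≤ countFin q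
countFin-mono p⊆q = count-mono {xs = allFin _} (All.tabulate λ {i} _ → p⊆q i)

countFin-strict : ∀ {n} {p q : Fin n → Bool} → (∀ i → p i ≡ true → q i ≡ true) →
  ∀ i → q i ≡ true → p i ≡ false → countFin p < countFin q
countFin-strict p⊆q i = count-strict {xs = allFin _} (All.tabulate λ {i} _ → p⊆q i) (∈-allFin i)

anyFin-witness : ∀ {n} (f : Fin n → Bool) → anyFin f ≡ true → Σ (Fin n) λ i → f i ≡ true
anyFin-witness {suc n} f h with f zero in e
... | true  = zero , e
... | false = let (i , fi) = anyFin-witness (f ∘ suc) h in suc i , fi

anyFin-intro : ∀ {n} (f : Fin n → Bool) i → f i ≡ true → anyFin f ≡ true
anyFin-intro f zero    e rewrite e = refl
anyFin-intro f (suc i) e with f zero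
... | true  = refl
... | false = anyFin-intro (f ∘ suc) i e

anyFin-false : ∀ {n} (f : Fin n → Bool) i → anyFin f ≡ false → f i ≡ false
anyFin-false f i h = ¬-not λ fi → true≢false (trans (sym (anyFin-intro f i fi)) h)

anyFin-cong : ∀ {n} {f g : Fin n → Bool} → (∀ i → f i ≡ g i) → anyFin f ≡ anyFin g
anyFin-cong {zero}  e = refl
anyFin-cong {suc n} e = cong₂ _∨_ (e zero) (anyFin-cong (e ∘ suc))

updateAt-suc : ∀ {n} (c : Fin n → ℕ) j i → updateAt c j suc i ≡ bit (does (j Fin.≟ i)) + c i
updateAt-suc c j i with j Fin.≟ i
... | yes refl = updateAt-updates j c
... | no j≢i   = updateAt-minimal i j c (j≢i ∘ sym)

updateAt-pred : ∀ {n} (c : Fin n → ℕ) j {m} i → c j ≡ suc m → updateAt c j (λ _ → m) i + bit (does (j Fin.≟ i)) ≡ c i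
updateAt-pred c j {m} i cj with j Fin.≟ i
... | yes refl rewrite updateAt-updates j {f = λ _ → m} c | cj = +-comm m 1
... | no j≢i   rewrite updateAt-minimal i j {f = λ _ → m} c (j≢i ∘ sym) = +-identityʳ _

Listing : Set → Set
Listing X = Σ (List X) λ xs → ∀ x → x ∈ xs

module _ {X Y : Set} where

  listing-× : Listing X → Listing Y → Listing (X × Y)
  listing-× (xs , x∈) (ys , y∈) = cartesianProduct xs ys , λ (x , y) → ∈-cartesianProduct⁺ (x∈ x) (y∈ y)

  listing-⊎ : Listing X → Listing Y → Listing (X ⊎ Y)
  listing-⊎ (xs , x∈) (ys , y∈) = map inj₁ xs ++ map inj₂ ys , λ
    { (inj₁ x) → ∈-++⁺ˡ (∈-map⁺ inj₁ (x∈ x))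
    ; (inj₂ y) → ∈-++⁺ʳ (map inj₁ xs) (∈-map⁺ inj₂ (y∈ y)) }

  listing-onto : (f : X → Y) → (∀ y → Σ X λ x → f x ≡ y) → Listing X → Listing Y
  listing-onto f onto (xs , x∈) = map f xs , λ y → let (x , fx≡y) = onto y in subst (_∈ map f xs) fx≡y (∈-map⁺ f (x∈ x))

listing-Fin : ∀ n → Listing (Fin n)
listing-Fin n = allFin n , ∈-allFin

listing-Vec : ∀ {X : Set} n → Listing X → Listing (Vec X n)
listing-Vec zero    _ = Vec.[] ∷ [] , λ { Vec.[] → here refl }
listing-Vec (suc n) L = listing-onto (λ (x , xs) → x Vec.∷ xs) (λ { (x Vec.∷ xs) → (x , xs) , refl })
                          (listing-× L (listing-Vec n L))

listing-Maybe : ∀ {X : Set} → Listing X → Listing (Maybe X)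
listing-Maybe L = listing-onto [ just , (λ _ → nothing) ]′ (λ { (just x) → inj₁ x , refl ; nothing → inj₂ tt , refl })
                    (listing-⊎ L (tt ∷ [] , λ _ → here refl))

listing-CounterOp : ∀ k → Listing (CounterOp k)
listing-CounterOp k = listing-onto [ incr , [ decr , zeroTest ]′ ]′
  (λ { (incr i) → inj₁ i , refl ; (decr i) → inj₂ (inj₁ i) , refl ; (zeroTest i) → inj₂ (inj₂ i) , refl })
  (listing-⊎ (listing-Fin k) (listing-⊎ (listing-Fin k) (listing-Fin k)))

_≟ᵒ_ : ∀ {k} → DecidableEquality (CounterOp k)
incr i     ≟ᵒ incr j     = map′ (cong incr) (λ { refl → refl }) (i Fin.≟ j)
decr i     ≟ᵒ decr j     = map′ (cong decr) (λ { refl → refl }) (i Fin.≟ j)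
zeroTest i ≟ᵒ zeroTest j = map′ (cong zeroTest) (λ { refl → refl }) (i Fin.≟ j)
incr _     ≟ᵒ decr _     = no λ ()
incr _     ≟ᵒ zeroTest _ = no λ ()
decr _     ≟ᵒ incr _     = no λ ()
decr _     ≟ᵒ zeroTest _ = no λ ()
zeroTest _ ≟ᵒ incr _     = no λ ()
zeroTest _ ≟ᵒ decr _     = no λ ()

module FiniteMCA {s k : ℕ} {St : Set} (states : Listing St)
                 (Edge : St → Maybe (Fin s) → CounterOp k → St → Set)
                 (edge? : ∀ a l o b → Dec (Edge a l o b))
                 (initial final : St → Bool) where

  ⌜_⌝ : St → Fin (length (proj₁ states))
  ⌜ a ⌝ = Any.index (proj₂ states a)

  ⌞_⌟ : Fin (length (proj₁ states)) → St
  ⌞_⌟ = lookup (proj₁ states)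

  ⌞⌜⌝⌟ : ∀ a → ⌞ ⌜ a ⌝ ⌟ ≡ a
  ⌞⌜⌝⌟ a = sym (lookup-index (proj₂ states a))

  private
    quads : Listing (St × Maybe (Fin s) × CounterOp k × St)
    quads = listing-× states (listing-× (listing-Maybe (listing-Fin s)) (listing-× (listing-CounterOp k) states))

    edge : St × Maybe (Fin s) × CounterOp k × St → MCTrans (length (proj₁ states)) s k
    edge (a , l , o , b) = mkMCTr ⌜ a ⌝ l o ⌜ b ⌝

  M : MulticounterAutomaton s
  M = record
    { nq = length (proj₁ states)
    ; k  = k
    ; Δ  = map edge (filter (λ (a , l , o , b) → edge? a l o b) (proj₁ quads))
    ; J  = initial ∘ ⌞_⌟
    ; F  = final ∘ ⌞_⌟
    }

  edge-∈ : ∀ {a l o b} → Edge a l o b → mkMCTr ⌜ a ⌝ l o ⌜ b ⌝ ∈ MulticounterAutomaton.Δ M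
  edge-∈ {a} {l} {o} {b} e = ∈-map⁺ edge (∈-filter⁺ (λ (a , l , o , b) → edge? a l o b) (proj₂ quads (a , l , o , b)) e)

  ∈-edge : ∀ {t} → t ∈ MulticounterAutomaton.Δ M →
    Σ St λ a → Σ (Maybe (Fin s)) λ l → Σ (CounterOp k) λ o → Σ St λ b → Edge a l o b × t ≡ mkMCTr ⌜ a ⌝ l o ⌜ b ⌝
  ∈-edge t∈ with ∈-map⁻ edge t∈
  ... | (a , l , o , b) , q∈ , refl = a , l , o , b , proj₂ (∈-filter⁻ (λ (a , l , o , b) → edge? a l o b) {xs = proj₁ quads} q∈) , refl

  data Run : St → Counters k → List (Fin s) → Set where
    done  : ∀ {a c} → final a ≡ true → (∀ i → c i ≡ 0) → Run a c []
    stepε : ∀ {a b c c′ o w} → Edge a nothing o b → OpStep o c c′ → Run b c′ w → Run a c w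
    stepa : ∀ {a b c c′ o x w} → Edge a (just x) o b → OpStep o c c′ → Run b c′ w → Run a c (x ∷ w)

  Run⇒MCAccRun : ∀ {a c w} → Run a c w → MCAccRun M (⌜ a ⌝ , c) w
  Run⇒MCAccRun {a} (done fin zeros) = done (trans (cong final (⌞⌜⌝⌟ a)) fin) zeros
  Run⇒MCAccRun (stepε e op run) = stepε _ (edge-∈ e) refl refl op (Run⇒MCAccRun run)
  Run⇒MCAccRun (stepa e op run) = stepa _ (edge-∈ e) refl refl op (Run⇒MCAccRun run)

  -- A state may occur several times in the listing, so a run of M may start at any index of it.
  MCAccRun⇒Run : ∀ {i c w} → MCAccRun M (i , c) w → Run ⌞ i ⌟ c w
  MCAccRun⇒Run (done fin zeros) = done fin zeros
  MCAccRun⇒Run (stepε t t∈ src≡ lab≡ op run) with ∈-edge t∈ | src≡ | lab≡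
  ... | a , _ , _ , b , e , refl | refl | refl =
    subst (λ x → Run x _ _) (sym (⌞⌜⌝⌟ a)) (stepε e op (subst (λ x → Run x _ _) (⌞⌜⌝⌟ b) (MCAccRun⇒Run run)))
  MCAccRun⇒Run (stepa t t∈ src≡ lab≡ op run) with ∈-edge t∈ | src≡ | lab≡
  ... | a , _ , _ , b , e , refl | refl | refl =
    subst (λ x → Run x _ _) (sym (⌞⌜⌝⌟ a)) (stepa e op (subst (λ x → Run x _ _) (⌞⌜⌝⌟ b) (MCAccRun⇒Run run)))

  data Path : St → Counters k → St → Counters k → Set where
    []  : ∀ {a c} → Path a c a c
    _∷_ : ∀ {a b b′ c c′ c″ o} → Edge a nothing o b × OpStep o c c′ → Path b c′ b′ c″ → Path a c b′ c″

  _++ᵖ_ : ∀ {a b b′ c c′ c″} → Path a c b c′ → Path b c′ b′ c″ → Path a c b′ c″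
  []       ++ᵖ q = q
  (e ∷ p) ++ᵖ q = e ∷ (p ++ᵖ q)

  Path-Run : ∀ {a b c c′ w} → Path a c b c′ → Run b c′ w → Run a c w
  Path-Run []             run = run
  Path-Run ((e , op) ∷ p) run = stepε e op (Path-Run p run)

module Simulation {s : ℕ} (A : SetAutomaton s) (normal : Normal A) (ordered : Ordered A) where
  open SetAutomaton A
  open SATrans
  open Ordered ordered
  open import Data.List.Membership.DecPropositional (Fin._≟_ {ny}) using (_∈?_)

  -- Transitions are handled through their positions τ in Δ, so that they range over a finite type.
  nΔ : ℕ
  nΔ = length Δ

  δ : Fin nΔ → SATrans nq ny s
  δ = lookup Δ

  δ∈Δ : ∀ τ → δ τ ∈ Δ
  δ∈Δ = ∈-lookup

  normalδ : ∀ τ → NormalTrans A (δ τ)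
  normalδ τ = normal (δ τ) (δ∈Δ τ)

  move : Fin nΔ → Fin ny → Fin ny
  move τ = proj₁ (proj₁ (normalδ τ))

  ins : Fin nΔ → Fin ny
  ins τ = proj₁ (proj₁ (proj₂ (normalδ τ)))

  ρ-move : ∀ τ x y → ρ (δ τ) x y ≡ does (move τ x Fin.≟ y)
  ρ-move τ x y = bool-ext (λ h → dec-true (move τ x Fin.≟ y) (proj₁ (spec x y) h))
                          (λ h → proj₂ (spec x y) (from-does (move τ x Fin.≟ y) h))
    where spec = proj₂ (proj₁ (normalδ τ))

  uv-ins : ∀ τ y → uv (δ τ) y ≡ does (ins τ Fin.≟ y)
  uv-ins τ y = bool-ext (λ h → dec-true (ins τ Fin.≟ y) (sym (proj₁ (spec y) h)))
                        (λ h → proj₂ (spec y) (sym (from-does (ins τ Fin.≟ y) h)))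
    where spec = proj₂ (proj₁ (proj₂ (normalδ τ)))

  ρ-δ-move : ∀ τ x → ρ (δ τ) x (move τ x) ≡ true
  ρ-δ-move τ x = trans (ρ-move τ x (move τ x)) (dec-true (move τ x Fin.≟ move τ x) refl)

  Y₀ Y₁ : Fin nΔ → Fin ny → Bool
  Y₀ τ = proj₁ (partition (δ τ) (δ∈Δ τ))
  Y₁ τ = proj₁ (proj₂ (partition (δ τ) (δ∈Δ τ)))

  ¬Bounded⇒Y₀⊎Y₁ : ∀ τ y → ¬ Bounded A y → Y₀ τ y ≡ true ⊎ Y₁ τ y ≡ true
  ¬Bounded⇒Y₀⊎Y₁ τ y = proj₁ (proj₁ (proj₂ (proj₂ (partition (δ τ) (δ∈Δ τ)))) y)

  Y₀⊎Y₁⇒¬Bounded : ∀ τ y → Y₀ τ y ≡ true ⊎ Y₁ τ y ≡ true → ¬ Bounded A y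
  Y₀⊎Y₁⇒¬Bounded τ y = proj₁ (proj₂ (proj₁ (proj₂ (proj₂ (partition (δ τ) (δ∈Δ τ)))) y))

  Y₀-Y₁-disjoint : ∀ τ y → ¬ (Y₀ τ y ≡ true × Y₁ τ y ≡ true)
  Y₀-Y₁-disjoint τ y = proj₂ (proj₂ (proj₁ (proj₂ (proj₂ (partition (δ τ) (δ∈Δ τ)))) y))

  Y₀-below-Y₁ : ∀ τ x y → Y₀ τ x ≡ true → Y₁ τ y ≡ true → x ≼ y
  Y₀-below-Y₁ τ = proj₁ (proj₂ (proj₂ (proj₂ (partition (δ τ) (δ∈Δ τ)))))

  move-Y₀ : ∀ τ x → Y₀ τ x ≡ true → Y₁ τ (move τ x) ≡ true
  move-Y₀ τ x x∈Y₀ = proj₁ (proj₂ (proj₂ (proj₂ (proj₂ (partition (δ τ) (δ∈Δ τ)))))) x (move τ x) x∈Y₀ (ρ-δ-move τ x)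

  move-Y₁ : ∀ τ x → Y₁ τ x ≡ true → move τ x ≡ x
  move-Y₁ τ x x∈Y₁ =
    proj₁ (proj₂ (proj₂ (proj₂ (proj₂ (proj₂ (partition (δ τ) (δ∈Δ τ)))))) x (move τ x) x∈Y₁) (ρ-δ-move τ x)

  Y₁⇒∉Y₀ : ∀ τ x → Y₁ τ x ≡ true → Y₀ τ x ≡ false
  Y₁⇒∉Y₀ τ x x∈Y₁ = ¬-not λ x∈Y₀ → Y₀-Y₁-disjoint τ x (x∈Y₀ , x∈Y₁)

  move-Y₀-∉Y₀ : ∀ τ x → Y₀ τ x ≡ true → Y₀ τ (move τ x) ≡ false
  move-Y₀-∉Y₀ τ x = Y₁⇒∉Y₀ τ (move τ x) ∘ move-Y₀ τ x

  -- Boundedness is decided through the partitions: a name is unbounded iff it lies in Y₀ ∪ Y₁ of some transition.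
  unbounded : Fin ny → Bool
  unbounded y = anyFin (λ τ → Y₀ τ y ∨ Y₁ τ y)

  Y₀⇒unbounded : ∀ τ x → Y₀ τ x ≡ true → unbounded x ≡ true
  Y₀⇒unbounded τ x e = anyFin-intro (λ τ → Y₀ τ x ∨ Y₁ τ x) τ (cong (_∨ Y₁ τ x) e)

  Y₁⇒unbounded : ∀ τ x → Y₁ τ x ≡ true → unbounded x ≡ true
  Y₁⇒unbounded τ x e = anyFin-intro (λ τ → Y₀ τ x ∨ Y₁ τ x) τ (trans (cong (Y₀ τ x ∨_) e) (∨-zeroʳ _))

  unbounded⇒¬Bounded : ∀ {y} → unbounded y ≡ true → ¬ Bounded A y
  unbounded⇒¬Bounded {y} h = let (τ , e) = anyFin-witness _ h in Y₀⊎Y₁⇒¬Bounded τ y (∨-true e)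

  bounded⇒Bounded : ∀ {y} → unbounded y ≡ false → Bounded A y
  bounded⇒Bounded {y} h z z⁺z z≡y⊎z⁺y =
    [ ∉Y₀ , ∉Y₁ ]′ (¬Bounded⇒Y₀⊎Y₁ τ y ¬B)
    where
    τ = Any.index (proj₂ (used z⁺z))
      where
      used : ∀ {x y} → Plus A x y → Σ _ (_∈ Δ)
      used (base t t∈Δ _) = t , t∈Δ
      used (⁺-trans p _)  = used p
    ¬B : ¬ Bounded A y
    ¬B B = B z z⁺z z≡y⊎z⁺y
    Y₀∨Y₁≡false = anyFin-false (λ τ → Y₀ τ y ∨ Y₁ τ y) τ h
    ∉Y₀ : Y₀ τ y ≢ true
    ∉Y₀ e = true≢false (trans (sym (cong (_∨ Y₁ τ y) e)) Y₀∨Y₁≡false)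
    ∉Y₁ : Y₁ τ y ≢ true
    ∉Y₁ e = true≢false (trans (sym (trans (cong (Y₀ τ y ∨_) e) (∨-zeroʳ _))) Y₀∨Y₁≡false)

  unbounded⇒Y₀⊎Y₁ : ∀ τ x → unbounded x ≡ true → Y₀ τ x ≡ true ⊎ Y₁ τ x ≡ true
  unbounded⇒Y₀⊎Y₁ τ x = ¬Bounded⇒Y₀⊎Y₁ τ x ∘ unbounded⇒¬Bounded

  move-unbounded : ∀ τ x → unbounded x ≡ true → unbounded (move τ x) ≡ true
  move-unbounded τ x e with unbounded⇒Y₀⊎Y₁ τ x e
  ... | inj₁ x∈Y₀ = Y₁⇒unbounded τ _ (move-Y₀ τ x x∈Y₀)
  ... | inj₂ x∈Y₁ = subst (λ z → unbounded z ≡ true) (sym (move-Y₁ τ x x∈Y₁)) e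

  move-bounded⁻ : ∀ τ x → unbounded (move τ x) ≡ false → unbounded x ≡ false
  move-bounded⁻ τ x e = ¬-not λ u → true≢false (trans (sym (move-unbounded τ x u)) e)

  -- Counters numbered along the order of set names

  private module ≼ = IsTotalOrder isTotal

  _≺_ : Fin ny → Fin ny → Set
  x ≺ y = x ≼ y × x ≢ y

  _≼?_ : ∀ x y → Dec (x ≼ y)
  x ≼? y with x Fin.≟ y | ≼.total x y
  ... | yes x≡y | _        = yes (≼.reflexive x≡y)
  ... | no _    | inj₁ x≼y = yes x≼y
  ... | no x≢y  | inj₂ y≼x = no λ x≼y → x≢y (≼.antisym x≼y y≼x)

  _≺?_ : ∀ x y → Dec (x ≺ y)
  x ≺? y = (x ≼? y) ×-dec ¬? (x Fin.≟ y)

  ≺-trans : ∀ {x y z} → x ≺ y → y ≺ z → x ≺ z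
  ≺-trans (x≼y , x≢y) (y≼z , y≢z) =
    ≼.trans x≼y y≼z , λ { refl → x≢y (≼.antisym x≼y y≼z) }

  ≺-irrefl : ∀ {x} → ¬ x ≺ x
  ≺-irrefl (_ , x≢x) = x≢x refl

  ≺-connex : ∀ {x y} → x ≢ y → x ≺ y ⊎ y ≺ x
  ≺-connex {x} {y} x≢y with ≼.total x y
  ... | inj₁ x≼y = inj₁ (x≼y , x≢y)
  ... | inj₂ y≼x = inj₂ (y≼x , x≢y ∘ sym)

  rank : Fin ny → ℕ
  rank y = countFin (λ x → does (x ≺? y))

  rank<ny : ∀ y → rank y < ny
  rank<ny y = countFin<n _ y (dec-false (y ≺? y) ≺-irrefl)

  ≺⇒rank< : ∀ {x y} → x ≺ y → rank x < rank y
  ≺⇒rank< {x} {y} x≺y =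
    countFin-strict (λ z z≺x → dec-true (z ≺? y) (≺-trans (from-does (z ≺? x) z≺x) x≺y))
      x (dec-true (x ≺? y) x≺y) (dec-false (x ≺? x) ≺-irrefl)

  rank-injective : ∀ {x y} → rank x ≡ rank y → x ≡ y
  rank-injective {x} {y} e with x Fin.≟ y
  ... | yes x≡y = x≡y
  ... | no x≢y with ≺-connex x≢y
  ...   | inj₁ x≺y = ⊥-elim (<-irrefl e (≺⇒rank< x≺y))
  ...   | inj₂ y≺x = ⊥-elim (<-irrefl (sym e) (≺⇒rank< y≺x))

  -- Counter 0 is never used, so that the zero test Z_{≤0} is an always enabled no-op.
  counter : Fin ny → Fin (suc ny)
  counter y = suc (Fin.fromℕ< (rank<ny y))

  toℕ-counter : ∀ y → toℕ (counter y) ≡ suc (rank y)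
  toℕ-counter y = cong suc (Fin.toℕ-fromℕ< (rank<ny y))

  counter-injective : ∀ {x y} → counter x ≡ counter y → x ≡ y
  counter-injective {x} {y} e =
    rank-injective (suc-injective (trans (sym (toℕ-counter x)) (trans (cong toℕ e) (toℕ-counter y))))

  Y₀-below-∉Y₀ : ∀ τ z x → Y₀ τ z ≡ true → Y₀ τ x ≡ false → z ≺ x
  Y₀-below-∉Y₀ τ z x z∈Y₀ x∉Y₀ = z≼x , λ { refl → true≢false (trans (sym z∈Y₀) x∉Y₀) }
    where
    z≼x : z ≼ x
    z≼x with unbounded x in ux
    ... | false = unboundedBelow z x (Y₀⊎Y₁⇒¬Bounded τ z (inj₁ z∈Y₀)) (bounded⇒Bounded ux)
    ... | true with unbounded⇒Y₀⊎Y₁ τ x ux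
    ...   | inj₁ x∈Y₀ = ⊥-elim (true≢false (trans (sym x∈Y₀) x∉Y₀))
    ...   | inj₂ x∈Y₁ = Y₀-below-Y₁ τ z x z∈Y₀ x∈Y₁

  Y₀-downClosed : ∀ τ z x → Y₀ τ x ≡ true → z ≺ x → Y₀ τ z ≡ true
  Y₀-downClosed τ z x x∈Y₀ (z≼x , z≢x) with Y₀ τ z in Y₀τz
  ... | true  = refl
  ... | false = ⊥-elim (z≢x (≼.antisym z≼x (proj₁ (Y₀-below-∉Y₀ τ x z x∈Y₀ Y₀τz))))

  -- Y₀ τ is an initial segment of the order, so it occupies exactly the counters 1 … threshold τ.
  threshold : Fin nΔ → Fin (suc ny)
  threshold τ = Fin.fromℕ< (s≤s (countFin≤n (Y₀ τ)))

  Y₀⇒counter≤threshold : ∀ τ x → Y₀ τ x ≡ true → toℕ (counter x) ≤ toℕ (threshold τ)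
  Y₀⇒counter≤threshold τ x x∈Y₀
    rewrite toℕ-counter x | Fin.toℕ-fromℕ< (s≤s (countFin≤n (Y₀ τ))) =
    countFin-strict (λ z z≺x → Y₀-downClosed τ z x x∈Y₀ (from-does (z ≺? x) z≺x))
      x x∈Y₀ (dec-false (x ≺? x) ≺-irrefl)

  counter≤threshold⇒Y₀ : ∀ τ x → toℕ (counter x) ≤ toℕ (threshold τ) → Y₀ τ x ≡ true
  counter≤threshold⇒Y₀ τ x h
    rewrite toℕ-counter x | Fin.toℕ-fromℕ< (s≤s (countFin≤n (Y₀ τ))) with Y₀ τ x in Y₀τx
  ... | true  = refl
  ... | false = ⊥-elim (<-irrefl refl (≤-trans h
                  (countFin-mono (λ z z∈Y₀ → dec-true (z ≺? x) (Y₀-below-∉Y₀ τ z x z∈Y₀ Y₀τx)))))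

  Plus-move : ∀ τ x → Plus A x (move τ x)
  Plus-move τ x = base (δ τ) (δ∈Δ τ) (ρ-δ-move τ x)

  endsPath : ℕ → Fin ny → Bool
  endsPath zero    _ = true
  endsPath (suc k) y = anyFin λ x → anyFin (λ τ → does (move τ x Fin.≟ y)) ∧ endsPath k x

  endsPath-move : ∀ τ x k → endsPath k x ≡ true → endsPath (suc k) (move τ x) ≡ true
  endsPath-move τ x k h =
    anyFin-intro _ x (∧-true (anyFin-intro _ τ (dec-true (move τ x Fin.≟ move τ x) refl)) h)

  endsPath-pred : ∀ k y → endsPath (suc k) y ≡ true →
    Σ (Fin ny) λ x → Σ (Fin nΔ) λ τ → move τ x ≡ y × endsPath k x ≡ true
  endsPath-pred k y h =
    let (x , e) = anyFin-witness _ h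
        (τ , e′) = anyFin-witness _ (∧-conicalˡ _ _ e)
    in x , τ , from-does (move τ x Fin.≟ y) e′ , ∧-conicalʳ _ _ e

  Bounded-pred : ∀ τ x → Bounded A (move τ x) → Bounded A x
  Bounded-pred τ x B z z⁺z (inj₁ refl) = B z z⁺z (inj₂ (Plus-move τ z))
  Bounded-pred τ x B z z⁺z (inj₂ z⁺x)  = B z z⁺z (inj₂ (⁺-trans z⁺x (Plus-move τ x)))

  -- The k names before y on a path of length k are distinct, as a repetition would be a cycle reaching y.
  path-distinct : ∀ k y → Bounded A y → endsPath k y ≡ true →
    Σ (List (Fin ny)) λ L → k ≤ countFin (λ x → does (x ∈? L)) × y ∉ L × (∀ {x} → x ∈ L → Plus A x y)
  path-distinct zero _ _ _ = [] , z≤n , (λ ()) , λ ()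
  path-distinct (suc k) y B h with endsPath-pred k y h
  ... | x , τ , refl , hx =
    let (L , k≤ , x∉L , L⁺x) = path-distinct k x (Bounded-pred τ x B) hx
        x⁺y = Plus-move τ x
        L⁺y : ∀ {z} → z ∈ x ∷ L → Plus A z y
        L⁺y = λ { (here refl) → x⁺y ; (there z∈L) → ⁺-trans (L⁺x z∈L) x⁺y }
    in x ∷ L ,
       ≤-trans (s≤s k≤) (countFin-strict {p = λ z → does (z ∈? L)} {q = λ z → does (z ∈? x ∷ L)}
                          (λ z z∈L → dec-true (z ∈? x ∷ L) (there (from-does (z ∈? L) z∈L)))
                          x (dec-true (x ∈? x ∷ L) (here refl)) (dec-false (x ∈? L) x∉L)) ,
       (λ y∈xL → B y (L⁺y y∈xL) (inj₁ refl)) ,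
       L⁺y

  bounded⇒¬endsPath : ∀ y → unbounded y ≡ false → endsPath ny y ≡ false
  bounded⇒¬endsPath y by = ¬-not λ h →
    let (L , ny≤ , y∉L , _) = path-distinct ny y (bounded⇒Bounded by) h
    in <-irrefl refl (≤-<-trans ny≤ (countFin<n (λ z → does (z ∈? L)) y (dec-false (y ∈? L) y∉L)))

  -- A configuration is represented by the list of pairs (e , y) with e stored in X_y; normality keeps the X_y disjoint.
  Loc : Set
  Loc = ℕ × Fin ny

  _≟ₗ_ : DecidableEquality Loc
  _≟ₗ_ = ≡-dec ℕ._≟_ Fin._≟_

  -- Opaque so that Agda infers D, y and e from sets D y e.
  opaque
    sets : List Loc → Fin ny → ℕ → Bool
    sets D y e = does ((e , y) ∈ₗ? D)
      where open import Data.List.Membership.DecPropositional _≟ₗ_ renaming (_∈?_ to _∈ₗ?_)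

  opaque
    unfolding sets

    sets-∈ : ∀ {D y e} → sets D y e ≡ true → (e , y) ∈ D
    sets-∈ {D} {y} {e} = from-does (Any.any? ((e , y) ≟ₗ_) D)

    ∈-sets : ∀ {D y e} → (e , y) ∈ D → sets D y e ≡ true
    ∈-sets {D} {y} {e} = dec-true (Any.any? ((e , y) ≟ₗ_) D)

  Fresh : ℕ → List Loc → Set
  Fresh d = All (λ p → d ≢ proj₁ p)

  Distinct : List Loc → Set
  Distinct = AllPairs (_≢_ on proj₁)

  fresh-∉ : ∀ {d D y} → Fresh d D → (d , y) ∉ D
  fresh-∉ (d≢d ∷ _)  (here refl) = d≢d refl
  fresh-∉ (_ ∷ fresh) (there d∈) = fresh-∉ fresh d∈

  sets-fresh : ∀ {d D} y → Fresh d D → sets D y d ≡ false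
  sets-fresh y fresh = ¬-not (fresh-∉ fresh ∘ sets-∈)

  Distinct-functional : ∀ {D d y y′} → Distinct D → (d , y) ∈ D → (d , y′) ∈ D → y ≡ y′
  Distinct-functional (_ ∷ _)        (here refl) (here refl) = refl
  Distinct-functional (fresh ∷ _)    (here refl) (there d∈)  = ⊥-elim (fresh-∉ fresh d∈)
  Distinct-functional (fresh ∷ _)    (there d∈)  (here refl) = ⊥-elim (fresh-∉ fresh d∈)
  Distinct-functional (_ ∷ distinct) (there d∈)  (there d∈′) = Distinct-functional distinct d∈ d∈′

  freshValue : List Loc → ℕ
  freshValue D = suc (foldr (λ p m → proj₁ p ⊔ m) 0 D)

  freshValue-fresh : ∀ D → Fresh (freshValue D) D
  freshValue-fresh D = go D ≤-refl
    where
    go : ∀ D {k} → foldr (λ p m → proj₁ p ⊔ m) 0 D < k → Fresh k D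
    go []            _ = []
    go ((e , _) ∷ D) h = (λ { refl → <-irrefl refl (≤-<-trans (m≤m⊔n e _) h) })
                        ∷ go D (≤-<-trans (m≤n⊔m e _) h)

  remove : ℕ → List Loc → List Loc
  remove d = filter (λ p → ¬? (d ℕ.≟ proj₁ p))

  remove-⊆ : ∀ {d D p} → p ∈ remove d D → p ∈ D
  remove-⊆ = proj₁ ∘ ∈-filter⁻ (λ p → ¬? (_ ℕ.≟ proj₁ p))

  remove-∈ : ∀ {d D e y} → e ≢ d → (e , y) ∈ D → (e , y) ∈ remove d D
  remove-∈ e≢d e∈ = ∈-filter⁺ (λ p → ¬? (_ ℕ.≟ proj₁ p)) e∈ (e≢d ∘ sym)

  remove-fresh : ∀ d D → Fresh d (remove d D)
  remove-fresh d = AllP.all-filter (λ p → ¬? (d ℕ.≟ proj₁ p))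

  remove-Distinct : ∀ d {D} → Distinct D → Distinct (remove d D)
  remove-Distinct d = AllPairs.filter⁺ (λ p → ¬? (d ℕ.≟ proj₁ p))

  remove-id : ∀ {d D} → Fresh d D → remove d D ≡ D
  remove-id = filter-all (λ p → ¬? (_ ℕ.≟ proj₁ p))

  count-remove : ∀ (p : Loc → Bool) {d y D} → Distinct D → (d , y) ∈ D →
    count p D ≡ bit (p (d , y)) + count p (remove d D)
  count-remove p {d} (fresh ∷ _) (here refl) =
    cong (λ L → bit (p (d , _)) + count p L)
      (sym (trans (filter-reject (λ q → ¬? (d ℕ.≟ proj₁ q)) (λ d≢d → d≢d refl)) (remove-id fresh)))
  count-remove p {d} {y} {(e , x) ∷ D} (fresh ∷ distinct) (there d∈) = begin
    bit (p (e , x)) + count p D                                 ≡⟨ cong (bit (p (e , x)) +_) (count-remove p distinct d∈) ⟩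
    bit (p (e , x)) + (bit (p (d , y)) + count p (remove d D))  ≡⟨ solve 3 (λ a b c → a :+ (b :+ c) := b :+ (a :+ c)) refl
                                                                     (bit (p (e , x))) (bit (p (d , y))) _ ⟩
    bit (p (d , y)) + count p ((e , x) ∷ remove d D)            ≡⟨ cong (λ L → bit (p (d , y)) + count p L)
                                                                     (sym (filter-accept (λ q → ¬? (d ℕ.≟ proj₁ q))
                                                                       (λ { refl → fresh-∉ fresh d∈ }))) ⟩
    bit (p (d , y)) + count p (remove d ((e , x) ∷ D))          ∎
    where open ≡-Reasoning

  relocate : Fin nΔ → Loc → Loc
  relocate τ (e , y) = e , move τ y

  after : Fin nΔ → ℕ → List Loc → List Loc
  after τ d D₀ = (d , ins τ) ∷ map (relocate τ) D₀

  after-Distinct : ∀ τ {d D₀} → Fresh d D₀ → Distinct D₀ → Distinct (after τ d D₀)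
  after-Distinct τ fresh distinct = AllP.map⁺ fresh ∷ AllPairs.map⁺ distinct

  sets-after-new : ∀ τ {d D₀ y} → Fresh d D₀ → sets (after τ d D₀) y d ≡ does (ins τ Fin.≟ y)
  sets-after-new τ {d} {D₀} {y} fresh = bool-ext to from
    where
    to : sets (after τ d D₀) y d ≡ true → does (ins τ Fin.≟ y) ≡ true
    to h with sets-∈ h
    ... | here refl = dec-true (ins τ Fin.≟ y) refl
    ... | there d∈ with ∈-map⁻ (relocate τ) d∈
    ...   | _ , d∈D₀ , refl = ⊥-elim (fresh-∉ fresh d∈D₀)
    from : does (ins τ Fin.≟ y) ≡ true → sets (after τ d D₀) y d ≡ true
    from h = ∈-sets (here (cong (d ,_) (sym (from-does (ins τ Fin.≟ y) h))))

  _≈_ : (X X′ : Fin ny → ℕ → Bool) → Set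
  X ≈ X′ = ∀ y e → X y e ≡ X′ y e

  applyTr-cong : ∀ t q {X X′} d → X ≈ X′ → proj₂ (applyTr A t (q , X) d) ≈ proj₂ (applyTr A t (q , X′) d)
  applyTr-cong t q d X≈X′ y e =
    cong (λ b → (b ∨ (uv t y ∧ does (e ℕ.≟ d))) ∧ not (vv t y ∧ does (e ℕ.≟ d)))
      (anyFin-cong λ x → cong (ρ t x y ∧_) (X≈X′ x e))

  AccRun-cong : ∀ {q X X′ w} → X ≈ X′ → AccRun A (q , X) w → AccRun A (q , X′) w
  AccRun-cong {X = X} {X′} X≈X′ (done (q∈F , accepting)) = done (q∈F , accepting′)
    where
    accepting′ : ∀ e → (Σ (Fin ny) λ y → X′ y e ≡ true) → _∈C A (charVec A X′ e)
    accepting′ e (y , e∈X′) =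
      let (c , c∈C , c≐) = accepting e (y , trans (X≈X′ y e) e∈X′)
      in c , c∈C , λ z → trans (c≐ z) (X≈X′ z e)
  AccRun-cong {q} X≈X′ (step {d = d} t t∈Δ (src≡ , lab≡ , zv≐) run) =
    step t t∈Δ (src≡ , lab≡ , λ z → trans (zv≐ z) (X≈X′ z d)) (AccRun-cong (applyTr-cong t q d X≈X′) run)

  read-other : ∀ a u v → (a ∨ (u ∧ false)) ∧ not (v ∧ false) ≡ a
  read-other a u v rewrite ∧-zeroʳ u | ∧-zeroʳ v = trans (∧-identityʳ _) (∨-identityʳ a)

  _≐?_ : (u v : Vec𝟚 ny) → Dec (u ≐ v)
  u ≐? v = Fin.all? (λ y → u y Bool.≟ v y)

  unitVec : Fin ny → Vec𝟚 ny
  unitVec y x = does (x Fin.≟ y)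

  unitVec-sets : ∀ {D d y} → Distinct D → (d , y) ∈ D → ∀ x → unitVec y x ≡ sets D x d
  unitVec-sets {y = y} distinct d∈ x =
    bool-ext (λ x≡y → ∈-sets (subst (λ z → (_ , z) ∈ _) (sym (from-does (x Fin.≟ y) x≡y)) d∈))
             (λ d∈x → dec-true (x Fin.≟ _) (Distinct-functional distinct (sets-∈ d∈x) d∈))

  module Read (τ : Fin nΔ) {d : ℕ} {D : List Loc} (distinct : Distinct D)
              (zv≐ : ∀ x → zv (δ τ) x ≡ sets D x d) where

    t : SATrans nq ny s
    t = δ τ

    stays : ∀ y {e} → e ≢ d → anyFin (λ x → ρ t x y ∧ sets D x e) ≡ sets (after τ d (remove d D)) y e
    stays y {e} e≢d = bool-ext to from
      where
      to : anyFin (λ x → ρ t x y ∧ sets D x e) ≡ true → sets (after τ d (remove d D)) y e ≡ true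
      to h = let (x , ρxy∧e∈x) = anyFin-witness _ h
                 x↦y = from-does (move τ x Fin.≟ y) (trans (sym (ρ-move τ x y)) (∧-conicalˡ _ _ ρxy∧e∈x))
                 e∈x = sets-∈ (∧-conicalʳ _ _ ρxy∧e∈x)
             in ∈-sets (there (subst (λ z → (e , z) ∈ _) x↦y (∈-map⁺ (relocate τ) (remove-∈ e≢d e∈x))))
      from : sets (after τ d (remove d D)) y e ≡ true → anyFin (λ x → ρ t x y ∧ sets D x e) ≡ true
      from h with sets-∈ h
      ... | here refl = ⊥-elim (e≢d refl)
      ... | there e∈ with ∈-map⁻ (relocate τ) e∈
      ...   | (_ , x) , e∈x , refl = anyFin-intro _ x (∧-true (ρ-δ-move τ x) (∈-sets (remove-⊆ e∈x)))

    image : Vec𝟚 ny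
    image = ρ t [ zv t ]ᵣ

    image-sets : ∀ y → anyFin (λ x → ρ t x y ∧ sets D x d) ≡ image y
    image-sets y = anyFin-cong λ x → trans (∧-comm (ρ t x y) _) (cong (_∧ ρ t x y) (sym (zv≐ x)))

    image-source : ∀ {y} → image y ≡ true → Σ (Fin ny) λ x → (d , x) ∈ D × move τ x ≡ y
    image-source {y} h =
      let (x , zx∧ρxy) = anyFin-witness _ h
      in x , sets-∈ (trans (sym (zv≐ x)) (∧-conicalˡ _ _ zx∧ρxy)) ,
         from-does (move τ x Fin.≟ y) (trans (sym (ρ-move τ x y)) (∧-conicalʳ _ _ zx∧ρxy))

    -- d lies in at most one set, so its image under ρ is zero or a unit vector.
    image-unit : ∀ {y} → image y ≡ true → image ≐ unitVec y
    image-unit {y} h y′ = bool-ext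
      (λ h′ → let (x , d∈x , x↦y) = image-source h ; (x′ , d∈x′ , x′↦y′) = image-source h′
              in dec-true (y′ Fin.≟ y) (trans (sym x′↦y′)
                   (trans (cong (move τ) (Distinct-functional distinct d∈x′ d∈x)) x↦y)))
      (λ y′≡y → subst (λ z → image z ≡ true) (sym (from-does (y′ Fin.≟ y) y′≡y)) h)

    -- By normality v is ρ[z] when that differs from u, and then, being zero or a unit vector, it is disjoint
    -- from u; either way d ends up exactly in ins τ.
    inserted : ∀ y → (image y ∨ uv t y) ∧ not (vv t y) ≡ does (ins τ Fin.≟ y)
    inserted y with uv t ≐? image | proj₂ (proj₂ (normalδ τ))
    ... | yes uv≐image | (_ , uv≐image⇒vv≐0) rewrite uv≐image⇒vv≐0 uv≐image y | uv≐image y =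
      trans (∧-identityʳ _) (trans (∨-idem (image y)) (trans (sym (uv≐image y)) (uv-ins τ y)))
    ... | no uv≉image | (uv≉image⇒vv≐image , _) rewrite uv≉image⇒vv≐image uv≉image y with image y in image-y
    ...   | false = trans (∧-identityʳ _) (uv-ins τ y)
    ...   | true  = sym (¬-not λ ins≟y → uv≉image λ y′ →
                      trans (uv-ins τ y′) (trans (cong (λ z → does (z Fin.≟ y′)) (from-does (ins τ Fin.≟ y) ins≟y))
                        (trans (does-≟-sym y y′) (sym (image-unit image-y y′)))))

    applyTr-sets : ∀ q → proj₂ (applyTr A t (q , sets D) d) ≈ sets (after τ d (remove d D))
    applyTr-sets q y e with e ℕ.≟ d in e≟d
    ... | no e≢d = begin
      (anyFin (λ x → ρ t x y ∧ sets D x e) ∨ (uv t y ∧ does (e ℕ.≟ d))) ∧ not (vv t y ∧ does (e ℕ.≟ d))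
        ≡⟨ cong (λ b → (anyFin (λ x → ρ t x y ∧ sets D x e) ∨ (uv t y ∧ b)) ∧ not (vv t y ∧ b)) (cong does e≟d) ⟩
      (anyFin (λ x → ρ t x y ∧ sets D x e) ∨ (uv t y ∧ false)) ∧ not (vv t y ∧ false)
        ≡⟨ read-other _ (uv t y) (vv t y) ⟩
      anyFin (λ x → ρ t x y ∧ sets D x e)
        ≡⟨ stays y e≢d ⟩
      sets (after τ d (remove d D)) y e ∎
      where open ≡-Reasoning
    ... | yes refl = begin
      (anyFin (λ x → ρ t x y ∧ sets D x d) ∨ (uv t y ∧ does (d ℕ.≟ d))) ∧ not (vv t y ∧ does (d ℕ.≟ d))
        ≡⟨ cong (λ b → (anyFin (λ x → ρ t x y ∧ sets D x d) ∨ (uv t y ∧ b)) ∧ not (vv t y ∧ b)) (cong does e≟d) ⟩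
      (anyFin (λ x → ρ t x y ∧ sets D x d) ∨ (uv t y ∧ true)) ∧ not (vv t y ∧ true)
        ≡⟨ cong₂ (λ a b → (a ∨ b) ∧ not (vv t y ∧ true)) (image-sets y) (∧-identityʳ _) ⟩
      (image y ∨ uv t y) ∧ not (vv t y ∧ true)
        ≡⟨ cong (λ b → (image y ∨ uv t y) ∧ not b) (∧-identityʳ _) ⟩
      (image y ∨ uv t y) ∧ not (vv t y)
        ≡⟨ inserted y ⟩
      does (ins τ Fin.≟ y)
        ≡⟨ sym (sets-after-new τ (remove-fresh d D)) ⟩
      sets (after τ d (remove d D)) y d ∎
      where open ≡-Reasoning

  -- The simulating multicounter automaton

  Counts : Set
  Counts = Vec (Fin (suc ny)) ny

  empty : Counts
  empty = Vec.replicate ny zero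

  -- Opaque for the same reason as sets.
  opaque
    infixl 9 _!_
    _!_ : Counts → Fin ny → ℕ
    bc ! y = toℕ (Vec.lookup bc y)

    empty-! : ∀ y → empty ! y ≡ 0
    empty-! y = cong toℕ (Vec.lookup-replicate y zero)

  𝟙[_≡_] : Fin ny → Fin ny → ℕ
  𝟙[ x ≡ y ] = bit (does (x Fin.≟ y))

  Inc : Counts → Fin ny → Counts → Set
  Inc bc y bc′ = ∀ z → bc′ ! z ≡ bc ! z + 𝟙[ z ≡ y ]

  Op : Set
  Op = CounterOp (suc ny)

  noop : Op
  noop = zeroTest zero

  unitInC : Fin ny → Set
  unitInC y = _∈C A (unitVec y)

  -- A step by δ τ reads the datum (moveY₀ τ _), moves the data of Y₀ τ one by one through moveY₀′ until a
  -- zero test shows Y₀ τ empty, then moves the bounded data from old to new counts (moveB τ old new),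
  -- and finally inserts the datum into ins τ. In final q the counters of the unbounded sets are emptied.
  data State : Set where
    idle    : Fin nq → Counts → State
    moveY₀  : Fin nΔ → Counts → State
    moveY₀′ : Fin nΔ → Counts → Fin ny → State
    moveB   : Fin nΔ → Counts → Counts → State
    final   : Fin nq → State

  ReadEdge : Fin nΔ → Counts → Counts → Op → Set
  ReadEdge τ bc bc′ op =
    (Σ (Fin ny) λ y → zv (δ τ) ≐ unitVec y × unbounded y ≡ true × op ≡ decr (counter y) × bc′ ≡ bc)
    ⊎ (Σ (Fin ny) λ y → zv (δ τ) ≐ unitVec y × unbounded y ≡ false × Inc bc′ y bc × op ≡ noop)
    ⊎ (zv (δ τ) ≐ zeroVec × op ≡ noop × bc′ ≡ bc)

  MoveBEdge : Fin nΔ → Fin ny → Counts → Counts → Op → Set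
  MoveBEdge τ b new new′ op =
    (unbounded (move τ b) ≡ false × op ≡ noop × Inc new (move τ b) new′)
    ⊎ (unbounded (move τ b) ≡ true × op ≡ incr (counter (move τ b)) × new′ ≡ new)

  InsertEdge : Fin nΔ → Counts → Counts → Op → Set
  InsertEdge τ new bc′ op =
    (unbounded (ins τ) ≡ false × op ≡ noop × Inc new (ins τ) bc′)
    ⊎ (unbounded (ins τ) ≡ true × op ≡ incr (counter (ins τ)) × bc′ ≡ new)

  Edge : State → Maybe (Fin s) → Op → State → Set
  Edge (idle q bc)        l op (moveY₀ τ bc′)        = l ≡ just (lab (δ τ)) × src (δ τ) ≡ q × ReadEdge τ bc bc′ op
  Edge (idle q bc)        l op (final q′)            =
    l ≡ nothing × q′ ≡ q × F q ≡ true × op ≡ noop × (∀ y → unbounded y ≡ false → 1 ≤ bc ! y → unitInC y)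
  Edge (moveY₀ τ bc)      l op (moveY₀′ τ′ bc′ x)    =
    l ≡ nothing × τ′ ≡ τ × bc′ ≡ bc × Y₀ τ x ≡ true × op ≡ decr (counter x)
  Edge (moveY₀ τ bc)      l op (moveB τ′ old new)    =
    l ≡ nothing × τ′ ≡ τ × old ≡ bc × new ≡ empty × op ≡ zeroTest (threshold τ)
  Edge (moveY₀′ τ bc x)   l op (moveY₀ τ′ bc′)       =
    l ≡ nothing × τ′ ≡ τ × bc′ ≡ bc × op ≡ incr (counter (move τ x))
  Edge (moveB τ old new)  l op (idle q bc′)          =
    l ≡ nothing × q ≡ tgt (δ τ) × (∀ y → unbounded y ≡ false → old ! y ≡ 0) × InsertEdge τ new bc′ op
  Edge (moveB τ old new)  l op (moveB τ′ old′ new′)  =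
    l ≡ nothing × τ′ ≡ τ × Σ (Fin ny) λ b → unbounded b ≡ false × Inc old′ b old × MoveBEdge τ b new new′ op
  Edge (final q)          l op (final q′)            =
    l ≡ nothing × q′ ≡ q × Σ (Fin ny) λ y → unbounded y ≡ true × unitInC y × op ≡ decr (counter y)
  Edge _ _ _ _ = ⊥

  _∈C? : ∀ v → Dec (_∈C A v)
  v ∈C? with Any.any? (_≐? v) C
  ... | yes c∈ = let (c , c∈C , c≐v) = find c∈ in yes (c , c∈C , c≐v)
  ... | no c∉  = no λ (c , c∈C , c≐v) → c∉ (lose c∈C c≐v)

  private
    _≟ᶜ_ : DecidableEquality Counts
    _≟ᶜ_ = Vec.≡-dec Fin._≟_

    _≟ˡ_ : DecidableEquality (Maybe (Fin s))
    _≟ˡ_ = Maybe.≡-dec Fin._≟_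

    inc? : ∀ bc y bc′ → Dec (Inc bc y bc′)
    inc? bc y bc′ = Fin.all? λ z → bc′ ! z ℕ.≟ (bc ! z + 𝟙[ z ≡ y ])

    ⊥? : Dec ⊥
    ⊥? = no λ ()

  readEdge? : ∀ τ bc bc′ op → Dec (ReadEdge τ bc bc′ op)
  readEdge? τ bc bc′ op =
    Fin.any? (λ y → (zv (δ τ) ≐? unitVec y) ×-dec (unbounded y Bool.≟ true) ×-dec (op ≟ᵒ decr (counter y)) ×-dec (bc′ ≟ᶜ bc))
    ⊎-dec Fin.any? (λ y → (zv (δ τ) ≐? unitVec y) ×-dec (unbounded y Bool.≟ false) ×-dec inc? bc′ y bc ×-dec (op ≟ᵒ noop))
    ⊎-dec ((zv (δ τ) ≐? zeroVec) ×-dec (op ≟ᵒ noop) ×-dec (bc′ ≟ᶜ bc))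

  moveBEdge? : ∀ τ b new new′ op → Dec (MoveBEdge τ b new new′ op)
  moveBEdge? τ b new new′ op =
    ((unbounded (move τ b) Bool.≟ false) ×-dec (op ≟ᵒ noop) ×-dec inc? new (move τ b) new′)
    ⊎-dec ((unbounded (move τ b) Bool.≟ true) ×-dec (op ≟ᵒ incr (counter (move τ b))) ×-dec (new′ ≟ᶜ new))

  insertEdge? : ∀ τ new bc′ op → Dec (InsertEdge τ new bc′ op)
  insertEdge? τ new bc′ op =
    ((unbounded (ins τ) Bool.≟ false) ×-dec (op ≟ᵒ noop) ×-dec inc? new (ins τ) bc′)
    ⊎-dec ((unbounded (ins τ) Bool.≟ true) ×-dec (op ≟ᵒ incr (counter (ins τ))) ×-dec (bc′ ≟ᶜ new))

  edge? : ∀ a l op b → Dec (Edge a l op b)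
  edge? (idle _ _)        _ _  (idle _ _)           = ⊥?
  edge? (idle q bc)       l op (moveY₀ τ bc′)       = (l ≟ˡ just (lab (δ τ))) ×-dec (src (δ τ) Fin.≟ q) ×-dec readEdge? τ bc bc′ op
  edge? (idle _ _)        _ _  (moveY₀′ _ _ _)      = ⊥?
  edge? (idle _ _)        _ _  (moveB _ _ _)        = ⊥?
  edge? (idle q bc)       l op (final q′)           =
    (l ≟ˡ nothing) ×-dec (q′ Fin.≟ q) ×-dec (F q Bool.≟ true) ×-dec (op ≟ᵒ noop)
    ×-dec Fin.all? (λ y → (unbounded y Bool.≟ false) →-dec ((1 ℕ.≤? bc ! y) →-dec (unitVec y ∈C?)))
  edge? (moveY₀ _ _)      _ _  (idle _ _)           = ⊥?
  edge? (moveY₀ _ _)      _ _  (moveY₀ _ _)         = ⊥?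
  edge? (moveY₀ τ bc)     l op (moveY₀′ τ′ bc′ x)   =
    (l ≟ˡ nothing) ×-dec (τ′ Fin.≟ τ) ×-dec (bc′ ≟ᶜ bc) ×-dec (Y₀ τ x Bool.≟ true) ×-dec (op ≟ᵒ decr (counter x))
  edge? (moveY₀ τ bc)     l op (moveB τ′ old new)   =
    (l ≟ˡ nothing) ×-dec (τ′ Fin.≟ τ) ×-dec (old ≟ᶜ bc) ×-dec (new ≟ᶜ empty) ×-dec (op ≟ᵒ zeroTest (threshold τ))
  edge? (moveY₀ _ _)      _ _  (final _)            = ⊥?
  edge? (moveY₀′ _ _ _)   _ _  (idle _ _)           = ⊥?
  edge? (moveY₀′ τ bc x)  l op (moveY₀ τ′ bc′)      =
    (l ≟ˡ nothing) ×-dec (τ′ Fin.≟ τ) ×-dec (bc′ ≟ᶜ bc) ×-dec (op ≟ᵒ incr (counter (move τ x)))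
  edge? (moveY₀′ _ _ _)   _ _  (moveY₀′ _ _ _)      = ⊥?
  edge? (moveY₀′ _ _ _)   _ _  (moveB _ _ _)        = ⊥?
  edge? (moveY₀′ _ _ _)   _ _  (final _)            = ⊥?
  edge? (moveB τ old new) l op (idle q bc′)         =
    (l ≟ˡ nothing) ×-dec (q Fin.≟ tgt (δ τ)) ×-dec Fin.all? (λ y → (unbounded y Bool.≟ false) →-dec (old ! y ℕ.≟ 0))
    ×-dec insertEdge? τ new bc′ op
  edge? (moveB _ _ _)     _ _  (moveY₀ _ _)         = ⊥?
  edge? (moveB _ _ _)     _ _  (moveY₀′ _ _ _)      = ⊥?
  edge? (moveB τ old new) l op (moveB τ′ old′ new′) =
    (l ≟ˡ nothing) ×-dec (τ′ Fin.≟ τ)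
    ×-dec Fin.any? (λ b → (unbounded b Bool.≟ false) ×-dec inc? old′ b old ×-dec moveBEdge? τ b new new′ op)
  edge? (moveB _ _ _)     _ _  (final _)            = ⊥?
  edge? (final _)         _ _  (idle _ _)           = ⊥?
  edge? (final _)         _ _  (moveY₀ _ _)         = ⊥?
  edge? (final _)         _ _  (moveY₀′ _ _ _)      = ⊥?
  edge? (final _)         _ _  (moveB _ _ _)        = ⊥?
  edge? (final q)         l op (final q′)           =
    (l ≟ˡ nothing) ×-dec (q′ Fin.≟ q)
    ×-dec Fin.any? (λ y → (unbounded y Bool.≟ true) ×-dec (unitVec y ∈C?) ×-dec (op ≟ᵒ decr (counter y)))

  states : Listing State
  states = listing-onto toState onto
    (listing-⊎ (listing-× Qs Cs) (listing-⊎ (listing-× Ts Cs) (listing-⊎ (listing-× Ts (listing-× Cs Ys))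
      (listing-⊎ (listing-× Ts (listing-× Cs Cs)) Qs))))
    where
    Qs = listing-Fin nq
    Ts = listing-Fin nΔ
    Ys = listing-Fin ny
    Cs = listing-Vec ny (listing-Fin (suc ny))
    StateCode : Set
    StateCode = (Fin nq × Counts) ⊎ (Fin nΔ × Counts) ⊎ (Fin nΔ × Counts × Fin ny) ⊎ (Fin nΔ × Counts × Counts) ⊎ Fin nq
    toState : StateCode → State
    toState = [ (λ (q , bc) → idle q bc) , [ (λ (τ , bc) → moveY₀ τ bc) , [ (λ (τ , bc , x) → moveY₀′ τ bc x)
              , [ (λ (τ , old , new) → moveB τ old new) , final ]′ ]′ ]′ ]′
    onto : ∀ a → Σ StateCode λ p → toState p ≡ a
    onto (idle q bc)       = inj₁ (q , bc) , refl
    onto (moveY₀ τ bc)     = inj₂ (inj₁ (τ , bc)) , refl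
    onto (moveY₀′ τ bc x)  = inj₂ (inj₂ (inj₁ (τ , bc , x))) , refl
    onto (moveB τ old new) = inj₂ (inj₂ (inj₂ (inj₁ (τ , old , new)))) , refl
    onto (final q)         = inj₂ (inj₂ (inj₂ (inj₂ q))) , refl

  isInitial isFinal : State → Bool
  isInitial (idle q bc) = I q ∧ does (bc ≟ᶜ empty)
  isInitial _           = false
  isFinal (final _) = true
  isFinal _         = false

  open FiniteMCA states Edge edge? isInitial isFinal public

  onCounter : Fin (suc ny) → Loc → Bool
  onCounter i (_ , y) = unbounded y ∧ does (counter y Fin.≟ i)

  load : List Loc → Fin (suc ny) → ℕ
  load D i = count (onCounter i) D

  inSet : Fin ny → Loc → Bool
  inSet y (_ , x) = does (x Fin.≟ y)

  size : List Loc → Fin ny → ℕ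
  size D y = count (inSet y) D

  CountersOf : List Loc → Counters (suc ny) → Set
  CountersOf D c = ∀ i → c i ≡ load D i

  IdleInv : List Loc → Counts → Counters (suc ny) → Set
  IdleInv D bc c = CountersOf D c × (∀ y → unbounded y ≡ false → bc ! y ≡ size D y)

  onCounter-unbounded : ∀ i e {y} → unbounded y ≡ true → onCounter i (e , y) ≡ does (counter y Fin.≟ i)
  onCounter-unbounded i e uy rewrite uy = refl

  onCounter-bounded : ∀ i e {y} → unbounded y ≡ false → onCounter i (e , y) ≡ false
  onCounter-bounded i e by rewrite by = refl

  onCounter-self : ∀ e {y} → unbounded y ≡ true → onCounter (counter y) (e , y) ≡ true
  onCounter-self e {y} uy = trans (onCounter-unbounded (counter y) e uy) (dec-true (counter y Fin.≟ counter y) refl)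

  unbounded-≢ : ∀ {y z} → unbounded y ≡ true → unbounded z ≡ false → y ≢ z
  unbounded-≢ uy bz refl = true≢false (trans (sym uy) bz)

  -- During a step every datum carries its set before the step and whether it has already been moved.
  Tagged : Set
  Tagged = ℕ × Fin ny × Bool

  origin : Tagged → Fin ny
  origin (_ , y , _) = y

  moved : Tagged → Bool
  moved (_ , _ , m) = m

  untag : Tagged → Loc
  untag (e , y , _) = e , y

  current : Fin nΔ → Tagged → Loc
  current τ (e , y , m) = e , (if m then move τ y else y)

  tag : Loc → Tagged
  tag (e , y) = e , y , false

  current-tag : ∀ τ D → map (current τ) (map tag D) ≡ D
  current-tag τ []      = refl
  current-tag τ (p ∷ D) = cong (p ∷_) (current-tag τ D)

  untag-tag : ∀ D → map untag (map tag D) ≡ D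
  untag-tag []      = refl
  untag-tag (p ∷ D) = cong (p ∷_) (untag-tag D)

  MovedFromY₀ : Fin nΔ → List Tagged → Set
  MovedFromY₀ τ = All (λ a → moved a ≡ true → Y₀ τ (origin a) ≡ true)

  MovedFromY₀-tag : ∀ τ D → MovedFromY₀ τ (map tag D)
  MovedFromY₀-tag τ []      = []
  MovedFromY₀-tag τ (p ∷ D) = (λ ()) ∷ MovedFromY₀-tag τ D

  Y₀Moved : Fin nΔ → List Tagged → Set
  Y₀Moved τ = All (λ a → Y₀ τ (origin a) ≡ true → moved a ≡ true)

  MoveY₀Inv : Fin nΔ → List Tagged → Counts → Counters (suc ny) → Set
  MoveY₀Inv τ DT bc c =
    CountersOf (map (current τ) DT) c × (∀ y → unbounded y ≡ false → bc ! y ≡ size (map untag DT) y) × MovedFromY₀ τ DT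

  CountersOf-replace : ∀ τ pre post {a a′ c c′} → CountersOf (map (current τ) (pre ++ a ∷ post)) c →
    (∀ i → c′ i + bit (onCounter i (current τ a)) ≡ c i + bit (onCounter i (current τ a′))) →
    CountersOf (map (current τ) (pre ++ a′ ∷ post)) c′
  CountersOf-replace τ pre post {a} {a′} {c′ = c′} ctr adjust i =
    subst (c′ i ≡_) (sym (count-map (onCounter i) (current τ) (pre ++ a′ ∷ post)))
      (count-replace-≡ (onCounter i ∘ current τ) pre a a′ post
        (trans (ctr i) (count-map (onCounter i) (current τ) (pre ++ a ∷ post))) (adjust i))

  unmovedIn : Fin ny → Tagged → Bool
  unmovedIn y a = not (moved a) ∧ does (origin a Fin.≟ y)

  movedInto : Fin nΔ → Fin ny → Tagged → Bool
  movedInto τ y a = moved a ∧ not (unbounded (origin a)) ∧ does (move τ (origin a) Fin.≟ y)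

  MovedOK : Fin nΔ → List Tagged → Set
  MovedOK τ = All (λ a → moved a ≡ true → Y₀ τ (origin a) ≡ true ⊎ unbounded (origin a) ≡ false)

  MoveBInv : Fin nΔ → List Tagged → Counts → Counts → Counters (suc ny) → Set
  MoveBInv τ DT old new c = CountersOf (map (current τ) DT) c
    × (∀ y → unbounded y ≡ false → old ! y ≡ count (unmovedIn y) DT)
    × (∀ y → unbounded y ≡ false → new ! y ≡ count (movedInto τ y) DT)
    × Y₀Moved τ DT × MovedOK τ DT

  BoundedMoved : List Tagged → Set
  BoundedMoved = All (λ a → unbounded (origin a) ≡ false → moved a ≡ true)

  MoveY₀Inv-tag : ∀ τ {D bc c} → IdleInv D bc c → MoveY₀Inv τ (map tag D) bc c
  MoveY₀Inv-tag τ {D} (ctr , bnd) rewrite current-tag τ D | untag-tag D = ctr , bnd , MovedFromY₀-tag τ D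

  read-unbounded-inv : ∀ τ {D bc c d y m} → Distinct D → IdleInv D bc c → (d , y) ∈ D → unbounded y ≡ true →
    c (counter y) ≡ suc m → MoveY₀Inv τ (map tag (remove d D)) bc (updateAt c (counter y) (λ _ → m))
  read-unbounded-inv τ {D} {bc} {c} {d} {y} {m} distinct (ctr , bnd) d∈ uy cy = MoveY₀Inv-tag τ (ctr′ , bnd′)
    where
    ctr′ : CountersOf (remove d D) (updateAt c (counter y) (λ _ → m))
    ctr′ i = +-cancelʳ-≡ (bit (does (counter y Fin.≟ i))) _ _ (begin
      updateAt c (counter y) (λ _ → m) i + bit (does (counter y Fin.≟ i)) ≡⟨ updateAt-pred c (counter y) i cy ⟩
      c i                                                                 ≡⟨ ctr i ⟩
      load D i                                                            ≡⟨ count-remove (onCounter i) distinct d∈ ⟩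
      bit (onCounter i (d , y)) + load (remove d D) i                     ≡⟨ cong (λ b → bit b + _) (onCounter-unbounded i d uy) ⟩
      bit (does (counter y Fin.≟ i)) + load (remove d D) i                ≡⟨ +-comm _ (load (remove d D) i) ⟩
      load (remove d D) i + bit (does (counter y Fin.≟ i))                ∎)
      where open ≡-Reasoning
    bnd′ : ∀ z → unbounded z ≡ false → bc ! z ≡ size (remove d D) z
    bnd′ z bz = trans (bnd z bz) (trans (count-remove (inSet z) distinct d∈)
                  (cong (λ b → bit b + size (remove d D) z) (dec-false (y Fin.≟ z) (unbounded-≢ uy bz))))

  read-bounded-inv : ∀ τ {D bc bc′ c d y} → Distinct D → IdleInv D bc c → (d , y) ∈ D → unbounded y ≡ false →
    Inc bc′ y bc → MoveY₀Inv τ (map tag (remove d D)) bc′ c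
  read-bounded-inv τ {D} {bc} {bc′} {c} {d} {y} distinct (ctr , bnd) d∈ by inc = MoveY₀Inv-tag τ (ctr′ , bnd′)
    where
    ctr′ : CountersOf (remove d D) c
    ctr′ i = trans (ctr i) (trans (count-remove (onCounter i) distinct d∈)
               (cong (λ b → bit b + load (remove d D) i) (onCounter-bounded i d by)))
    bnd′ : ∀ z → unbounded z ≡ false → bc′ ! z ≡ size (remove d D) z
    bnd′ z bz = +-cancelʳ-≡ 𝟙[ z ≡ y ] _ _ (begin
      bc′ ! z + 𝟙[ z ≡ y ]                        ≡⟨ sym (inc z) ⟩
      bc ! z                                      ≡⟨ bnd z bz ⟩
      size D z                                    ≡⟨ count-remove (inSet z) distinct d∈ ⟩
      bit (does (y Fin.≟ z)) + size (remove d D) z ≡⟨ cong (λ b → bit b + _) (does-≟-sym y z) ⟩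
      𝟙[ z ≡ y ] + size (remove d D) z             ≡⟨ +-comm 𝟙[ z ≡ y ] _ ⟩
      size (remove d D) z + 𝟙[ z ≡ y ]             ∎)
      where open ≡-Reasoning

  read-fresh-inv : ∀ τ {D bc c d} → IdleInv D bc c → Fresh d D → MoveY₀Inv τ (map tag (remove d D)) bc c
  read-fresh-inv τ inv fresh rewrite remove-id fresh = MoveY₀Inv-tag τ inv

  moveY₀-inv : ∀ τ pre post {e x bc c m} → MoveY₀Inv τ (pre ++ (e , x , false) ∷ post) bc c → Y₀ τ x ≡ true →
    c (counter x) ≡ suc m →
    MoveY₀Inv τ (pre ++ (e , x , true) ∷ post) bc (updateAt (updateAt c (counter x) (λ _ → m)) (counter (move τ x)) suc)
  moveY₀-inv τ pre post {e} {x} {bc} {c} {m} (ctr , bnd , fromY₀) x∈Y₀ cx =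
    CountersOf-replace τ pre post ctr adjust ,
    subst (λ L → ∀ y → unbounded y ≡ false → bc ! y ≡ size L y) (map-replace untag pre post refl) bnd ,
    All-replace pre post fromY₀ (λ _ → x∈Y₀)
    where
    ux = Y₀⇒unbounded τ x x∈Y₀
    c′ = updateAt (updateAt c (counter x) (λ _ → m)) (counter (move τ x)) suc
    adjust : ∀ i → c′ i + bit (onCounter i (e , x)) ≡ c i + bit (onCounter i (e , move τ x))
    adjust i = begin
      c′ i + bit (onCounter i (e , x))                   ≡⟨ cong (λ b → c′ i + bit b) (onCounter-unbounded i e ux) ⟩
      c′ i + bit (does (counter x Fin.≟ i))              ≡⟨ cong (_+ _) (updateAt-suc _ (counter (move τ x)) i) ⟩
      bit (does (counter (move τ x) Fin.≟ i)) + updateAt c (counter x) (λ _ → m) i + bit (does (counter x Fin.≟ i))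
                                                         ≡⟨ +-assoc (bit (does (counter (move τ x) Fin.≟ i))) _ _ ⟩
      bit (does (counter (move τ x) Fin.≟ i)) + (updateAt c (counter x) (λ _ → m) i + bit (does (counter x Fin.≟ i)))
                                                         ≡⟨ cong (bit (does (counter (move τ x) Fin.≟ i)) +_) (updateAt-pred c (counter x) i cx) ⟩
      bit (does (counter (move τ x) Fin.≟ i)) + c i      ≡⟨ +-comm _ (c i) ⟩
      c i + bit (does (counter (move τ x) Fin.≟ i))      ≡⟨ cong (λ b → c i + bit b) (sym (onCounter-unbounded i e (move-unbounded τ x ux))) ⟩
      c i + bit (onCounter i (e , move τ x))             ∎
      where open ≡-Reasoning

  zeroTest-sound : ∀ τ {DT bc c} → MoveY₀Inv τ DT bc c → (∀ j → toℕ j ≤ toℕ (threshold τ) → c j ≡ 0) → Y₀Moved τ DT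
  zeroTest-sound τ {DT} (ctr , _ , _) zeros = All.tabulate moved-if-Y₀
    where
    moved-if-Y₀ : ∀ {a} → a ∈ DT → Y₀ τ (origin a) ≡ true → moved a ≡ true
    moved-if-Y₀ {e , x , true}  _  _     = refl
    moved-if-Y₀ {e , x , false} a∈ x∈Y₀ = ⊥-elim (<-irrefl refl (≤-trans
      (count-∈ (onCounter (counter x)) (∈-map⁺ (current τ) a∈) (onCounter-self e (Y₀⇒unbounded τ x x∈Y₀)))
      (≤-reflexive (trans (sym (ctr (counter x))) (zeros (counter x) (Y₀⇒counter≤threshold τ x x∈Y₀))))))

  zeroTest-complete : ∀ τ {DT bc c} → MoveY₀Inv τ DT bc c → Y₀Moved τ DT → ∀ j → toℕ j ≤ toℕ (threshold τ) → c j ≡ 0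
  zeroTest-complete τ {DT} (ctr , _ , fromY₀) Y₀moved j j≤ =
    trans (ctr j) (trans (count-map (onCounter j) (current τ) DT)
      (count-allFalse (All.zipWith (λ {a} (p , q) → not-on-j {a} p q) (fromY₀ , Y₀moved))))
    where
    not-on-j : ∀ {a} → (moved a ≡ true → Y₀ τ (origin a) ≡ true) → (Y₀ τ (origin a) ≡ true → moved a ≡ true) →
               onCounter j (current τ a) ≡ false
    not-on-j {e , x , m} p q = ¬-not λ on-j →
      let y = proj₂ (current τ (e , x , m))
          counter≡j = from-does (counter y Fin.≟ j) (∧-conicalʳ _ _ on-j)
      in outside m p q (counter≤threshold⇒Y₀ τ y (subst (λ z → toℕ z ≤ toℕ (threshold τ)) (sym counter≡j) j≤))
      where
      outside : ∀ m → (m ≡ true → Y₀ τ x ≡ true) → (Y₀ τ x ≡ true → m ≡ true) → Y₀ τ (if m then move τ x else x) ≢ true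
      outside true  p _ y∈Y₀ = true≢false (trans (sym y∈Y₀) (move-Y₀-∉Y₀ τ x (p refl)))
      outside false _ q y∈Y₀ = true≢false (sym (q y∈Y₀))

  MoveY₀Inv⇒MoveBInv : ∀ τ {DT bc c} → MoveY₀Inv τ DT bc c → Y₀Moved τ DT → MoveBInv τ DT bc empty c
  MoveY₀Inv⇒MoveBInv τ {DT} {bc} (ctr , bnd , fromY₀) Y₀moved =
    ctr , old , new , Y₀moved , All.map (λ h m → inj₁ (h m)) fromY₀
    where
    old : ∀ y → unbounded y ≡ false → bc ! y ≡ count (unmovedIn y) DT
    old y by = trans (bnd y by) (trans (count-map (inSet y) untag DT) (count-cong (All.map (λ {a} → unmoved {a}) fromY₀)))
      where
      unmoved : ∀ {a} → (moved a ≡ true → Y₀ τ (origin a) ≡ true) → inSet y (untag a) ≡ unmovedIn y a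
      unmoved {e , x , false} _ = refl
      unmoved {e , x , true}  h = dec-false (x Fin.≟ y) (unbounded-≢ (Y₀⇒unbounded τ x (h refl)) by)
    new : ∀ y → unbounded y ≡ false → empty ! y ≡ count (movedInto τ y) DT
    new y _ = trans (empty-! y) (sym (count-allFalse (All.map (λ {a} → notInto {a}) fromY₀)))
      where
      notInto : ∀ {a} → (moved a ≡ true → Y₀ τ (origin a) ≡ true) → movedInto τ y a ≡ false
      notInto {e , x , false} _ = refl
      notInto {e , x , true}  h rewrite Y₀⇒unbounded τ x (h refl) = refl

  moveB-counters : ∀ τ {e b new new′ c c′ op} → unbounded b ≡ false → MoveBEdge τ b new new′ op → OpStep op c c′ →
    ∀ i → c′ i + bit (onCounter i (e , b)) ≡ c i + bit (onCounter i (e , move τ b))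
  moveB-counters τ {e} {c = c} bb (inj₁ (bmb , refl , _)) (doZero _ _) i =
    trans (cong (λ v → c i + bit v) (onCounter-bounded i e bb)) (cong (λ v → c i + bit v) (sym (onCounter-bounded i e bmb)))
  moveB-counters τ {e} {b} {c = c} bb (inj₂ (umb , refl , _)) (doIncr _) i = begin
    updateAt c (counter (move τ b)) suc i + bit (onCounter i (e , b)) ≡⟨ cong (λ v → updateAt c (counter (move τ b)) suc i + bit v)
                                                                           (onCounter-bounded i e bb) ⟩
    updateAt c (counter (move τ b)) suc i + 0                         ≡⟨ +-identityʳ _ ⟩
    updateAt c (counter (move τ b)) suc i                             ≡⟨ updateAt-suc c (counter (move τ b)) i ⟩
    bit (does (counter (move τ b) Fin.≟ i)) + c i                     ≡⟨ +-comm _ (c i) ⟩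
    c i + bit (does (counter (move τ b) Fin.≟ i))                     ≡⟨ cong (λ v → c i + bit v) (sym (onCounter-unbounded i e umb)) ⟩
    c i + bit (onCounter i (e , move τ b))                            ∎
    where open ≡-Reasoning

  moveB-news : ∀ τ {e b new new′ op} → unbounded b ≡ false → MoveBEdge τ b new new′ op →
    ∀ y → unbounded y ≡ false → new′ ! y + bit (movedInto τ y (e , b , false)) ≡ new ! y + bit (movedInto τ y (e , b , true))
  moveB-news τ {b = b} {new} bb (inj₁ (_ , _ , inc)) y by rewrite bb =
    trans (+-identityʳ _) (trans (inc y) (cong (λ v → new ! y + bit v) (does-≟-sym y (move τ b))))
  moveB-news τ {b = b} {new} bb (inj₂ (umb , _ , refl)) y by rewrite bb =
    cong (λ v → new ! y + bit v) (sym (dec-false (move τ b Fin.≟ y) (unbounded-≢ umb by)))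

  moveB-inv : ∀ τ pre post {e b old old′ new new′ c c′ op} →
    MoveBInv τ (pre ++ (e , b , false) ∷ post) old new c → unbounded b ≡ false → Inc old′ b old →
    MoveBEdge τ b new new′ op → OpStep op c c′ → MoveBInv τ (pre ++ (e , b , true) ∷ post) old′ new′ c′
  moveB-inv τ pre post {e} {b} {old′ = old′} (ctr , olds , news , Y₀moved , movedOK) bb inc mv os =
    CountersOf-replace τ pre post {a = e , b , false} ctr (moveB-counters τ {e} bb mv os) ,
    (λ y by → count-replace-≡ (unmovedIn y) pre (e , b , false) (e , b , true) post (olds y by)
                (trans (cong (λ v → old′ ! y + bit v) (does-≟-sym b y)) (trans (sym (inc y)) (sym (+-identityʳ _))))) ,
    (λ y by → count-replace-≡ (movedInto τ y) pre (e , b , false) (e , b , true) post (news y by) (moveB-news τ {e} bb mv y by)) ,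
    All-replace pre post Y₀moved (λ _ → refl) , All-replace pre post movedOK (λ _ → inj₂ bb)

  noOld⇒BoundedMoved : ∀ τ {DT old new c} → MoveBInv τ DT old new c → (∀ y → unbounded y ≡ false → old ! y ≡ 0) →
    BoundedMoved DT
  noOld⇒BoundedMoved τ {DT} (_ , olds , _) noOld = All.tabulate moved-if-bounded
    where
    moved-if-bounded : ∀ {a} → a ∈ DT → unbounded (origin a) ≡ false → moved a ≡ true
    moved-if-bounded {e , x , true}  _  _  = refl
    moved-if-bounded {e , x , false} a∈ bx = ⊥-elim (<-irrefl refl (≤-trans
      (count-∈ (unmovedIn x) a∈ (dec-true (x Fin.≟ x) refl)) (≤-reflexive (trans (sym (olds x bx)) (noOld x bx)))))

  current≡relocate : ∀ τ DT → Y₀Moved τ DT → BoundedMoved DT → map (current τ) DT ≡ map (relocate τ) (map untag DT)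
  current≡relocate τ [] _ _ = refl
  current≡relocate τ ((e , x , true)  ∷ DT) (_ ∷ Y₀moved) (_ ∷ bmoved) =
    cong ((e , move τ x) ∷_) (current≡relocate τ DT Y₀moved bmoved)
  current≡relocate τ ((e , x , false) ∷ DT) (x∉Y₀ ∷ Y₀moved) (x-unbounded ∷ bmoved) =
    cong₂ _∷_ (cong (e ,_) (sym stays)) (current≡relocate τ DT Y₀moved bmoved)
    where
    -- An unmoved datum lies neither in Y₀ nor in a bounded set, so it lies in Y₁, where move is the identity
    stays : move τ x ≡ x
    stays with unbounded⇒Y₀⊎Y₁ τ x (¬-not λ bx → true≢false (sym (x-unbounded bx)))
    ... | inj₁ x∈Y₀ = ⊥-elim (true≢false (sym (x∉Y₀ x∈Y₀)))
    ... | inj₂ x∈Y₁ = move-Y₁ τ x x∈Y₁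

  news+ins : ∀ τ {DT old new c} d → MoveBInv τ DT old new c → BoundedMoved DT →
    ∀ y → unbounded y ≡ false → new ! y + 𝟙[ y ≡ ins τ ] ≡ size (after τ d (map untag DT)) y
  news+ins τ {DT} {new = new} d (_ , _ , news , _ , _) bmoved y by = begin
    new ! y + 𝟙[ y ≡ ins τ ]                                 ≡⟨ cong (_+ 𝟙[ y ≡ ins τ ]) (news y by) ⟩
    count (movedInto τ y) DT + 𝟙[ y ≡ ins τ ]               ≡⟨ cong (_+ 𝟙[ y ≡ ins τ ])
                                                                 (count-cong (All.map (λ {a} → into {a}) bmoved)) ⟩
    count (inSet y ∘ relocate τ ∘ untag) DT + 𝟙[ y ≡ ins τ ] ≡⟨ +-comm _ 𝟙[ y ≡ ins τ ] ⟩
    𝟙[ y ≡ ins τ ] + count (inSet y ∘ relocate τ ∘ untag) DT ≡⟨ cong₂ _+_ (cong bit (does-≟-sym y (ins τ)))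
                                                                 (sym (trans (count-map (inSet y) (relocate τ) (map untag DT))
                                                                             (count-map _ untag DT))) ⟩
    size (after τ d (map untag DT)) y                        ∎
    where
    open ≡-Reasoning
    into : ∀ {a} → (unbounded (origin a) ≡ false → moved a ≡ true) → movedInto τ y a ≡ does (move τ (origin a) Fin.≟ y)
    into {e , x , m} bmoved-a with move τ x Fin.≟ y
    ... | no _ rewrite ∧-zeroʳ (not (unbounded x)) = ∧-zeroʳ m
    ... | yes refl rewrite bmoved-a (move-bounded⁻ τ x by) | move-bounded⁻ τ x by = refl

  insert-inv : ∀ τ {DT old new bc′ c c′ op} d → MoveBInv τ DT old new c → (∀ y → unbounded y ≡ false → old ! y ≡ 0) →
    InsertEdge τ new bc′ op → OpStep op c c′ → IdleInv (after τ d (map untag DT)) bc′ c′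
  insert-inv τ {DT} {new = new} {bc′ = bc′} {c = c} d inv@(ctr , _ , _ , Y₀moved , _) noOld ins-edge os =
    ctr′ ins-edge os , bnd′ ins-edge
    where
    bmoved : BoundedMoved DT
    bmoved = noOld⇒BoundedMoved τ inv noOld
    D₀ : List Loc
    D₀ = map (relocate τ) (map untag DT)
    ctr₀ : ∀ i → c i ≡ load D₀ i
    ctr₀ i = trans (ctr i) (cong (λ L → load L i) (current≡relocate τ DT Y₀moved bmoved))
    ctr′ : ∀ {c′ op} → InsertEdge τ new bc′ op → OpStep op c c′ → CountersOf (after τ d (map untag DT)) c′
    ctr′ (inj₁ (bi , refl , _)) (doZero _ _) i =
      trans (ctr₀ i) (cong (λ v → bit v + load D₀ i) (sym (onCounter-bounded i d bi)))
    ctr′ (inj₂ (ui , refl , _)) (doIncr _) i =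
      trans (updateAt-suc c (counter (ins τ)) i) (cong₂ _+_ (cong bit (sym (onCounter-unbounded i d ui))) (ctr₀ i))
    bnd′ : ∀ {op} → InsertEdge τ new bc′ op → ∀ y → unbounded y ≡ false → bc′ ! y ≡ size (after τ d (map untag DT)) y
    bnd′ (inj₁ (_ , _ , inc)) y by = trans (inc y) (news+ins τ d inv bmoved y by)
    bnd′ (inj₂ (ui , _ , refl)) y by = trans (sym (+-identityʳ _))
      (trans (cong (λ v → new ! y + bit v) (sym (dec-false (y Fin.≟ ins τ) (unbounded-≢ ui by ∘ sym))))
        (news+ins τ d inv bmoved y by))

  -- Soundness

  only-idle-reads : ∀ {a x op b} → Edge a (just x) op b → Σ (Fin nq) λ q → Σ Counts λ bc → a ≡ idle q bc
  only-idle-reads {idle q bc}       {b = moveY₀ _ _} _ = q , bc , refl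
  only-idle-reads {idle _ _}        {b = final _}    (() , _)
  only-idle-reads {moveY₀ _ _}      {b = moveY₀′ _ _ _} (() , _)
  only-idle-reads {moveY₀ _ _}      {b = moveB _ _ _}   (() , _)
  only-idle-reads {moveY₀′ _ _ _}   {b = moveY₀ _ _}    (() , _)
  only-idle-reads {moveB _ _ _}     {b = idle _ _}      (() , _)
  only-idle-reads {moveB _ _ _}     {b = moveB _ _ _}   (() , _)
  only-idle-reads {final _}         {b = final _}       (() , _)

  Realised : Fin nq → List Loc → List (Fin s) → Set
  Realised q D w = Σ (DataWord s) λ dw → AccRun A (q , sets D) dw × str dw ≡ w

  find-unbounded : ∀ D {y} → unbounded y ≡ true → 1 ≤ load D (counter y) → Σ ℕ λ d → (d , y) ∈ D
  find-unbounded D {y} uy h with count-witness (onCounter (counter y)) D h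
  ... | (d , x) , d∈ , on-y =
    d , subst (λ z → (d , z) ∈ D) (counter-injective (from-does (counter x Fin.≟ counter y) (∧-conicalʳ _ _ on-y))) d∈

  find-in-set : ∀ D {y} → 1 ≤ size D y → Σ ℕ λ d → (d , y) ∈ D
  find-in-set D {y} h with count-witness (inSet y) D h
  ... | (d , x) , d∈ , in-y = d , subst (λ z → (d , z) ∈ D) (from-does (x Fin.≟ y) in-y) d∈

  read-realised : ∀ τ {q d D w} → Distinct D → src (δ τ) ≡ q → (∀ x → zv (δ τ) x ≡ sets D x d) →
    Realised (tgt (δ τ)) (after τ d (remove d D)) w → Realised q D (lab (δ τ) ∷ w)
  read-realised τ {q} {d} distinct src≡ zv≐ (dw , run , str≡) =
    (lab (δ τ) , d) ∷ dw ,
    step (δ τ) (δ∈Δ τ) (src≡ , refl , zv≐) (AccRun-cong (λ y e → sym (Read.applyTr-sets τ distinct zv≐ q y e)) run) ,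
    cong (lab (δ τ) ∷_) str≡

  accepting : ∀ {q bc c D} → Distinct D → IdleInv D bc c → F q ≡ true →
    (∀ y → unbounded y ≡ false → 1 ≤ bc ! y → unitInC y) →
    (∀ y → unbounded y ≡ true → ¬ unitInC y → c (counter y) ≡ 0) → IsAccepting A (q , sets D)
  accepting {D = D} distinct (ctr , bnd) q∈F bounded-ok emptied = q∈F , λ e (y , e∈y) → charVec∈C (sets-∈ e∈y)
    where
    charVec∈C : ∀ {e y} → (e , y) ∈ D → _∈C A (charVec A (sets D) e)
    charVec∈C {e} {y} e∈ = let (c₀ , c₀∈C , c₀≐) = unit∈C (unbounded y) refl
                           in c₀ , c₀∈C , λ z → trans (c₀≐ z) (unitVec-sets distinct e∈ z)
      where
      unit∈C : ∀ u → unbounded y ≡ u → unitInC y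
      unit∈C false by = bounded-ok y by (≤-trans (count-∈ (inSet y) e∈ (dec-true (y Fin.≟ y) refl)) (≤-reflexive (sym (bnd y by))))
      unit∈C true  uy with unitVec y ∈C?
      ... | yes y∈C = y∈C
      ... | no y∉C  = ⊥-elim (<-irrefl refl (≤-trans (count-∈ (onCounter (counter y)) e∈ (onCounter-self e uy))
                                                  (≤-reflexive (trans (sym (ctr (counter y))) (emptied y uy y∉C)))))

  final-run : ∀ {q c w} → Run (final q) c w → w ≡ [] × (∀ y → unbounded y ≡ true → ¬ unitInC y → c (counter y) ≡ 0)
  final-run (done _ zeros) = refl , λ y _ _ → zeros (counter y)
  final-run (stepa e _ _) with only-idle-reads e
  ... | _ , _ , ()
  final-run {c = c} (stepε {b = final _} (_ , refl , y′ , _ , y′∈C , refl) (doDecr _ m _) run) =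
    let (w≡[] , emptied) = final-run run
    in w≡[] , λ y uy y∉C →
         trans (sym (updateAt-minimal (counter y) (counter y′) c (λ e → y∉C (subst unitInC (counter-injective (sym e)) y′∈C))))
               (emptied y uy y∉C)
  final-run (stepε {b = idle _ _} () _ _)
  final-run (stepε {b = moveY₀ _ _} () _ _)
  final-run (stepε {b = moveY₀′ _ _ _} () _ _)
  final-run (stepε {b = moveB _ _ _} () _ _)

  pick-unmovedY₀ : ∀ τ DT {x} → MovedFromY₀ τ DT → Y₀ τ x ≡ true → 1 ≤ load (map (current τ) DT) (counter x) →
    Σ (List Tagged) λ pre → Σ (List Tagged) λ post → Σ ℕ λ e → DT ≡ pre ++ (e , x , false) ∷ post
  pick-unmovedY₀ τ DT {x} fromY₀ x∈Y₀ h with count-witness (onCounter (counter x)) (map (current τ) DT) h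
  ... | p , p∈ , on-x with ∈-map⁻ (current τ) p∈
  ... | (e , z , true) , a∈ , refl =
    let moved-to-x = counter-injective (from-does (counter (move τ z) Fin.≟ counter x) (∧-conicalʳ (unbounded (move τ z)) _ on-x))
    in ⊥-elim (true≢false (trans (sym x∈Y₀) (trans (cong (Y₀ τ) (sym moved-to-x)) (move-Y₀-∉Y₀ τ z (All.lookup fromY₀ a∈ refl)))))
  ... | (e , z , false) , a∈ , refl with counter-injective (from-does (counter z Fin.≟ counter x) (∧-conicalʳ _ _ on-x))
  ...   | refl = let (pre , post , DT≡) = ∈-∃++ a∈ in pre , post , e , DT≡

  pick-unmovedB : ∀ DT {b} → 1 ≤ count (unmovedIn b) DT →
    Σ (List Tagged) λ pre → Σ (List Tagged) λ post → Σ ℕ λ e → DT ≡ pre ++ (e , b , false) ∷ post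
  pick-unmovedB DT {b} h with count-witness (unmovedIn b) DT h
  ... | (e , z , false) , a∈ , unmoved with from-does (z Fin.≟ b) unmoved
  ...   | refl = let (pre , post , DT≡) = ∈-∃++ a∈ in pre , post , e , DT≡

  1≤Inc : ∀ {bc y bc′} → Inc bc y bc′ → 1 ≤ bc′ ! y
  1≤Inc {bc} {y} inc = subst (1 ≤_) (sym (inc y)) (subst (λ v → 1 ≤ bc ! y + v) (sym (cong bit (dec-true (y Fin.≟ y) refl))) (m≤n+m 1 _))

  mutual
    sound-idle : ∀ {q bc c D w} → Distinct D → IdleInv D bc c → Run (idle q bc) c w → Realised q D w
    sound-idle _ _ (done () _)
    sound-idle distinct inv (stepε {b = final q} (refl , refl , q∈F , refl , bounded-ok) (doZero _ _) run)
      with final-run run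
    ... | refl , emptied = [] , done (accepting distinct inv q∈F bounded-ok emptied) , refl
    sound-idle distinct inv (stepa {b = moveY₀ τ bc′} (refl , src≡ , read) os run) = sound-read τ distinct inv src≡ read os run
    sound-idle _ _ (stepε {b = idle _ _} () _ _)
    sound-idle _ _ (stepε {b = moveY₀ _ _} (() , _) _ _)
    sound-idle _ _ (stepε {b = moveY₀′ _ _ _} () _ _)
    sound-idle _ _ (stepε {b = moveB _ _ _} () _ _)
    sound-idle _ _ (stepa {b = idle _ _} () _ _)
    sound-idle _ _ (stepa {b = moveY₀′ _ _ _} () _ _)
    sound-idle _ _ (stepa {b = moveB _ _ _} () _ _)
    sound-idle _ _ (stepa {b = final _} (() , _) _ _)

    sound-read : ∀ τ {q bc bc′ c c′ op D w} → Distinct D → IdleInv D bc c → src (δ τ) ≡ q →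
      ReadEdge τ bc bc′ op → OpStep op c c′ → Run (moveY₀ τ bc′) c′ w → Realised q D (lab (δ τ) ∷ w)
    sound-read τ {D = D} distinct inv src≡ (inj₁ (y , zv≐ , uy , refl , refl)) (doDecr _ m cy) run =
      let (d , d∈) = find-unbounded D uy (subst (1 ≤_) (proj₁ inv (counter y)) (subst (1 ≤_) (sym cy) (s≤s z≤n)))
      in read-realised τ distinct src≡ (λ x → trans (zv≐ x) (unitVec-sets distinct d∈ x))
           (sound-read-rest τ d D distinct (read-unbounded-inv τ distinct inv d∈ uy cy) run)
    sound-read τ {D = D} distinct inv src≡ (inj₂ (inj₁ (y , zv≐ , by , inc , refl))) (doZero _ _) run =
      let (d , d∈) = find-in-set D (subst (1 ≤_) (proj₂ inv y by) (1≤Inc inc))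
      in read-realised τ distinct src≡ (λ x → trans (zv≐ x) (unitVec-sets distinct d∈ x))
           (sound-read-rest τ d D distinct (read-bounded-inv τ distinct inv d∈ by inc) run)
    sound-read τ {D = D} distinct inv src≡ (inj₂ (inj₂ (zv≐0 , refl , refl))) (doZero _ _) run =
      read-realised τ distinct src≡ (λ x → trans (zv≐0 x) (sym (sets-fresh x (freshValue-fresh D))))
        (sound-read-rest τ (freshValue D) D distinct (read-fresh-inv τ inv (freshValue-fresh D)) run)

    sound-read-rest : ∀ τ d D {bc c w} → Distinct D → MoveY₀Inv τ (map tag (remove d D)) bc c →
      Run (moveY₀ τ bc) c w → Realised (tgt (δ τ)) (after τ d (remove d D)) w
    sound-read-rest τ d D distinct inv run =
      subst (λ D₀ → Realised (tgt (δ τ)) (after τ d D₀) _) (untag-tag (remove d D))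
        (sound-moveY₀ τ (subst Distinct (sym (untag-tag (remove d D))) (remove-Distinct d distinct))
                        (subst (Fresh d) (sym (untag-tag (remove d D))) (remove-fresh d D)) inv run)

    sound-moveY₀ : ∀ τ {DT bc c d w} → Distinct (map untag DT) → Fresh d (map untag DT) → MoveY₀Inv τ DT bc c →
      Run (moveY₀ τ bc) c w → Realised (tgt (δ τ)) (after τ d (map untag DT)) w
    sound-moveY₀ τ {DT} {d = d} {w} distinct fresh inv (stepε {b = moveY₀′ _ _ x} (refl , refl , refl , x∈Y₀ , refl) (doDecr _ m cx) run)
      with pick-unmovedY₀ τ DT (proj₂ (proj₂ inv)) x∈Y₀ (subst (1 ≤_) (proj₁ inv (counter x)) (subst (1 ≤_) (sym cx) (s≤s z≤n)))
    ... | pre , post , e , refl =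
      subst (λ D₀ → Realised (tgt (δ τ)) (after τ d D₀) w) (sym same)
        (sound-moveY₀′ τ (subst Distinct same distinct) (subst (Fresh d) same fresh) (moveY₀-inv τ pre post inv x∈Y₀ cx) run)
      where same = map-replace untag pre post refl
    sound-moveY₀ τ distinct fresh inv (stepε {b = moveB _ _ _} (refl , refl , refl , refl , refl) (doZero _ zeros) run) =
      sound-moveB τ distinct fresh (MoveY₀Inv⇒MoveBInv τ inv (zeroTest-sound τ inv zeros)) run
    sound-moveY₀ _ _ _ _ (done () _)
    sound-moveY₀ _ _ _ _ (stepa e _ _) with only-idle-reads e
    ... | _ , _ , ()
    sound-moveY₀ _ _ _ _ (stepε {b = idle _ _} () _ _)
    sound-moveY₀ _ _ _ _ (stepε {b = moveY₀ _ _} () _ _)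
    sound-moveY₀ _ _ _ _ (stepε {b = final _} () _ _)

    sound-moveY₀′ : ∀ τ {DT bc x c d w} → Distinct (map untag DT) → Fresh d (map untag DT) →
      MoveY₀Inv τ DT bc (updateAt c (counter (move τ x)) suc) → Run (moveY₀′ τ bc x) c w →
      Realised (tgt (δ τ)) (after τ d (map untag DT)) w
    sound-moveY₀′ τ distinct fresh inv (stepε {b = moveY₀ _ _} (refl , refl , refl , refl) (doIncr _) run) =
      sound-moveY₀ τ distinct fresh inv run
    sound-moveY₀′ _ _ _ _ (done () _)
    sound-moveY₀′ _ _ _ _ (stepa e _ _) with only-idle-reads e
    ... | _ , _ , ()
    sound-moveY₀′ _ _ _ _ (stepε {b = idle _ _} () _ _)
    sound-moveY₀′ _ _ _ _ (stepε {b = moveY₀′ _ _ _} () _ _)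
    sound-moveY₀′ _ _ _ _ (stepε {b = moveB _ _ _} () _ _)
    sound-moveY₀′ _ _ _ _ (stepε {b = final _} () _ _)

    sound-moveB : ∀ τ {DT old new c d w} → Distinct (map untag DT) → Fresh d (map untag DT) → MoveBInv τ DT old new c →
      Run (moveB τ old new) c w → Realised (tgt (δ τ)) (after τ d (map untag DT)) w
    sound-moveB τ {d = d} distinct fresh inv (stepε {b = idle _ _} (refl , refl , noOld , ins-edge) os run) =
      sound-idle (after-Distinct τ fresh distinct) (insert-inv τ d inv noOld ins-edge os) run
    sound-moveB τ {DT} {d = d} {w} distinct fresh inv (stepε {b = moveB _ _ _} (refl , refl , b , bb , inc , mv) os run)
      with pick-unmovedB DT (subst (1 ≤_) (proj₁ (proj₂ inv) b bb) (1≤Inc inc))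
    ... | pre , post , e , refl =
      subst (λ D₀ → Realised (tgt (δ τ)) (after τ d D₀) w) (sym same)
        (sound-moveB τ (subst Distinct same distinct) (subst (Fresh d) same fresh) (moveB-inv τ pre post inv bb inc mv os) run)
      where same = map-replace untag pre post refl
    sound-moveB _ _ _ _ (done () _)
    sound-moveB _ _ _ _ (stepa e _ _) with only-idle-reads e
    ... | _ , _ , ()
    sound-moveB _ _ _ _ (stepε {b = moveY₀ _ _} () _ _)
    sound-moveB _ _ _ _ (stepε {b = moveY₀′ _ _ _} () _ _)
    sound-moveB _ _ _ _ (stepε {b = final _} () _ _)

  -- Completeness

  opaque
    unfolding _!_

    !≤ny : ∀ bc y → bc ! y ≤ ny
    !≤ny bc y = ≤-pred (Fin.toℕ<n (Vec.lookup bc y))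

    fromSizes : (g : Fin ny → ℕ) → (∀ y → g y ≤ ny) → Counts
    fromSizes g g≤ = Vec.tabulate λ y → Fin.fromℕ< (s≤s (g≤ y))

    fromSizes-! : ∀ g g≤ y → fromSizes g g≤ ! y ≡ g y
    fromSizes-! g g≤ y = trans (cong toℕ (Vec.lookup∘tabulate _ y)) (Fin.toℕ-fromℕ< (s≤s (g≤ y)))

  decrement : ∀ bc y → 1 ≤ bc ! y → Σ Counts λ bc′ → Inc bc′ y bc
  decrement bc y 1≤ = fromSizes g g≤ , λ z → sym (trans (cong (_+ 𝟙[ z ≡ y ]) (fromSizes-! g g≤ z)) (m∸n+n≡m (𝟙≤ z)))
    where
    g : Fin ny → ℕ
    g z = bc ! z ∸ 𝟙[ z ≡ y ]
    g≤ : ∀ z → g z ≤ ny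
    g≤ z = ≤-trans (m∸n≤m (bc ! z) 𝟙[ z ≡ y ]) (!≤ny bc z)
    𝟙≤ : ∀ z → 𝟙[ z ≡ y ] ≤ bc ! z
    𝟙≤ z with z Fin.≟ y
    ... | yes refl = 1≤
    ... | no _     = z≤n

  increment : ∀ bc y → bc ! y < ny → Σ Counts λ bc′ → Inc bc y bc′
  increment bc y <ny = fromSizes g g≤ , fromSizes-! g g≤
    where
    g : Fin ny → ℕ
    g z = bc ! z + 𝟙[ z ≡ y ]
    g≤ : ∀ z → g z ≤ ny
    g≤ z with z Fin.≟ y
    ... | yes refl = subst (_≤ ny) (+-comm 1 _) <ny
    ... | no _     = subst (_≤ ny) (sym (+-identityʳ _)) (!≤ny bc z)

  load-zero : ∀ D → load D zero ≡ 0
  load-zero []            = refl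
  load-zero ((_ , y) ∷ D) rewrite ∧-zeroʳ (unbounded y) = load-zero D

  noop-step : ∀ D {c} → CountersOf D c → OpStep noop c c
  noop-step D ctr = doZero zero λ { zero _ → trans (ctr zero) (load-zero D) }

  -- A datum in a bounded set y that is not the end of a path of length k was inserted less than k steps ago;
  -- as one datum is inserted per step, there are at most k of them.
  young : ℕ → Loc → Bool
  young k (_ , y) = not (unbounded y) ∧ not (endsPath k y)

  Capacity : List Loc → Set
  Capacity D = ∀ k → count (young k) D ≤ k

  Capacity-remove : ∀ d {D} → Capacity D → Capacity (remove d D)
  Capacity-remove d {D} cap k = ≤-trans (count-filter≤ _ (λ p → ¬? (d ℕ.≟ proj₁ p)) D) (cap k)

  Capacity-after : ∀ τ d {D₀} → Capacity D₀ → Capacity (after τ d D₀)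
  Capacity-after τ d {D₀} _ zero =
    ≤-reflexive (count-allFalse {xs = after τ d D₀} (All.tabulate λ {(_ , y)} _ → ∧-zeroʳ (not (unbounded y))))
  Capacity-after τ d {D₀} cap (suc k) = +-mono-≤ (bit-mono {b = true} λ _ → refl)
    (≤-trans (≤-reflexive (count-map _ (relocate τ) D₀)) (≤-trans (count-mono {xs = D₀} (All.tabulate λ {(_ , y)} _ → younger y)) (cap k)))
    where
    younger : ∀ y → not (unbounded (move τ y)) ∧ not (endsPath (suc k) (move τ y)) ≡ true →
              not (unbounded y) ∧ not (endsPath k y) ≡ true
    younger y h = ∧-true (cong not (move-bounded⁻ τ y (not≡true (∧-conicalˡ _ _ h))))
                         (cong not (¬-not λ path → true≢false (trans (sym (endsPath-move τ y k path)) (not≡true (∧-conicalʳ _ _ h)))))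

  Capacity⇒size≤ny : ∀ {D} → Capacity D → ∀ y → unbounded y ≡ false → size D y ≤ ny
  Capacity⇒size≤ny {D} cap y by =
    ≤-trans (count-mono {xs = D} (All.tabulate λ {(_ , x)} _ x≡y → old x (from-does (x Fin.≟ y) x≡y))) (cap ny)
    where
    old : ∀ x → x ≡ y → not (unbounded x) ∧ not (endsPath ny x) ≡ true
    old x refl = ∧-true (cong not by) (cong not (bounded⇒¬endsPath y by))

  untag-snoc : ∀ pre {a a′} post → untag a ≡ untag a′ → map untag ((pre ++ [ a′ ]) ++ post) ≡ map untag (pre ++ a ∷ post)
  untag-snoc pre post same = trans (cong (map untag) (++-assoc pre _ post)) (sym (map-replace untag pre post same))

  move-one-path : ∀ τ {bc x c m} → Y₀ τ x ≡ true → c (counter x) ≡ suc m →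
    Path (moveY₀ τ bc) c (moveY₀ τ bc) (updateAt (updateAt c (counter x) (λ _ → m)) (counter (move τ x)) suc)
  move-one-path τ {bc} {x} x∈Y₀ cx =
    _∷_ {b = moveY₀′ τ bc x} ((refl , refl , refl , x∈Y₀ , refl) , doDecr _ _ cx) (((refl , refl , refl , refl) , doIncr _) ∷ [])

  moveY₀-all : ∀ τ {bc} pre post {c} → MoveY₀Inv τ (pre ++ post) bc c → Y₀Moved τ pre → All (λ a → moved a ≡ false) post →
    Σ (List Tagged) λ DT → Σ (Counters (suc ny)) λ c′ →
      Path (moveY₀ τ bc) c (moveY₀ τ bc) c′ × MoveY₀Inv τ DT bc c′ × Y₀Moved τ DT × map untag DT ≡ map untag (pre ++ post)
  moveY₀-all τ pre [] {c} inv Y₀moved [] =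
    pre ++ [] , c , [] , inv , subst (Y₀Moved τ) (sym (++-identityʳ pre)) Y₀moved , refl
  moveY₀-all τ {bc} pre ((e , x , _) ∷ post) {c} inv Y₀moved (refl ∷ unmoved) with Y₀ τ x in x∈Y₀
  ... | false =
    let (DT , c′ , path , inv′ , Y₀moved′ , untags) =
          moveY₀-all τ (pre ++ [ e , x , false ]) post (subst (λ L → MoveY₀Inv τ L bc c) (sym (++-assoc pre _ post)) inv)
            (AllP.++⁺ Y₀moved ((λ x∈ → ⊥-elim (true≢false (trans (sym x∈) x∈Y₀))) ∷ [])) unmoved
    in DT , c′ , path , inv′ , Y₀moved′ , trans untags (cong (map untag) (++-assoc pre _ post))
  ... | true =
    let (DT , c′ , path , inv′ , Y₀moved′ , untags) =
          moveY₀-all τ (pre ++ [ e , x , true ]) post (subst (λ L → MoveY₀Inv τ L bc c″) (sym (++-assoc pre _ post)) moved-x)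
            (AllP.++⁺ Y₀moved ((λ _ → refl) ∷ [])) unmoved
    in DT , c′ , move-one-path τ x∈Y₀ cx ++ᵖ path , inv′ , Y₀moved′ , trans untags (untag-snoc pre post refl)
    where
    ux = Y₀⇒unbounded τ x x∈Y₀
    x-occupied : 1 ≤ c (counter x)
    x-occupied = subst (1 ≤_) (sym (proj₁ inv (counter x)))
                   (count-∈ (onCounter (counter x)) (∈-map⁺ (current τ) (∈-++⁺ʳ pre (here refl))) (onCounter-self e ux))
    m = proj₁ (suc-of x-occupied)
    cx = proj₂ (suc-of x-occupied)
    c″ = updateAt (updateAt c (counter x) (λ _ → m)) (counter (move τ x)) suc
    moved-x : MoveY₀Inv τ (pre ++ (e , x , true) ∷ post) bc c″
    moved-x = moveY₀-inv τ pre post inv x∈Y₀ cx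

  NewFits : Fin nΔ → List Loc → Set
  NewFits τ D = ∀ y → unbounded y ≡ false → count (λ (_ , x) → does (move τ x Fin.≟ y)) D ≤ ny

  room-in-new : ∀ τ pre post {e b old new c} → MoveBInv τ (pre ++ (e , b , false) ∷ post) old new c →
    NewFits τ (map untag (pre ++ (e , b , false) ∷ post)) → unbounded (move τ b) ≡ false → new ! move τ b < ny
  room-in-new τ pre post {e} {b} {new = new} (_ , _ , news , _ , _) fits bmb = begin-strict
    new ! move τ b                                                   ≡⟨ news (move τ b) bmb ⟩
    count (movedInto τ (move τ b)) DT                                <⟨ count-strict {xs = DT}
                                                                          (All.tabulate λ {a} _ h → ∧-conicalʳ _ _ (∧-conicalʳ (moved a) _ h))
                                                                          (∈-++⁺ʳ pre (here refl)) (dec-true (move τ b Fin.≟ move τ b) refl)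
                                                                          refl ⟩
    count (λ a → does (move τ (origin a) Fin.≟ move τ b)) DT        ≡⟨ sym (count-map _ untag DT) ⟩
    count (λ (_ , x) → does (move τ x Fin.≟ move τ b)) (map untag DT) ≤⟨ fits (move τ b) bmb ⟩
    ny                                                               ∎
    where
    open ≤-Reasoning
    DT = pre ++ (e , b , false) ∷ post

  old-pending : ∀ τ pre post {e b old new c} → MoveBInv τ (pre ++ (e , b , false) ∷ post) old new c →
    unbounded b ≡ false → 1 ≤ old ! b
  old-pending τ pre post {b = b} (_ , olds , _) bb =
    subst (1 ≤_) (sym (olds b bb)) (count-∈ (unmovedIn b) (∈-++⁺ʳ pre (here refl)) (dec-true (b Fin.≟ b) refl))

  moveB-one : ∀ τ pre post {e b old new c} → MoveBInv τ (pre ++ (e , b , false) ∷ post) old new c →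
    NewFits τ (map untag (pre ++ (e , b , false) ∷ post)) → unbounded b ≡ false →
    Σ Counts λ old′ → Σ Counts λ new′ → Σ (Counters (suc ny)) λ c′ → Σ Op λ op →
      Edge (moveB τ old new) nothing op (moveB τ old′ new′) × OpStep op c c′ ×
      MoveBInv τ (pre ++ (e , b , true) ∷ post) old′ new′ c′
  moveB-one τ pre post {e} {b} {old} {new} {c} inv fits bb
    with decrement old b (old-pending τ pre post inv bb) | unbounded (move τ b) in umb
  ... | old′ , inc | true =
    old′ , new , _ , _ , (refl , refl , b , bb , inc , mv) , doIncr _ , moveB-inv τ pre post inv bb inc mv (doIncr _)
    where
    mv : MoveBEdge τ b new new (incr (counter (move τ b)))
    mv = inj₂ (umb , refl , refl)
  ... | old′ , inc | false with increment new (move τ b) (room-in-new τ pre post inv fits umb)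
  ...   | new′ , inc′ =
    old′ , new′ , c , noop , (refl , refl , b , bb , inc , mv) , no-op , moveB-inv τ pre post inv bb inc mv no-op
    where
    mv : MoveBEdge τ b new new′ noop
    mv = inj₁ (umb , refl , inc′)
    no-op : OpStep noop c c
    no-op = noop-step (map (current τ) (pre ++ (e , b , false) ∷ post)) (proj₁ inv)

  moveB-skip : ∀ τ pre post {a old new c} → MoveBInv τ (pre ++ a ∷ post) old new c → BoundedMoved pre →
    NewFits τ (map untag (pre ++ a ∷ post)) → (unbounded (origin a) ≡ false → moved a ≡ true) →
    Σ (List Tagged) λ DT → Σ Counts λ old′ → Σ Counts λ new′ → Σ (Counters (suc ny)) λ c′ →
      Path (moveB τ old new) c (moveB τ old′ new′) c′ × MoveBInv τ DT old′ new′ c′ × BoundedMoved DT ×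
      map untag DT ≡ map untag (pre ++ a ∷ post)
  moveB-all : ∀ τ pre post {old new c} → MoveBInv τ (pre ++ post) old new c → BoundedMoved pre →
    NewFits τ (map untag (pre ++ post)) →
    Σ (List Tagged) λ DT → Σ Counts λ old′ → Σ Counts λ new′ → Σ (Counters (suc ny)) λ c′ →
      Path (moveB τ old new) c (moveB τ old′ new′) c′ × MoveBInv τ DT old′ new′ c′ × BoundedMoved DT ×
      map untag DT ≡ map untag (pre ++ post)
  moveB-all τ pre [] {old} {new} {c} inv bmoved _ =
    pre ++ [] , old , new , c , [] , inv , subst BoundedMoved (sym (++-identityʳ pre)) bmoved , refl
  moveB-all τ pre ((e , x , true) ∷ post) inv bmoved fits = moveB-skip τ pre post inv bmoved fits (λ _ → refl)
  moveB-all τ pre ((e , x , false) ∷ post) inv bmoved fits with unbounded x in ux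
  ... | true  = moveB-skip τ pre post inv bmoved fits (λ bx → ⊥-elim (true≢false (trans (sym ux) bx)))
  ... | false =
    let (old′ , new′ , c′ , op , edge , os , inv′) = moveB-one τ pre post inv fits ux
        (DT , old″ , new″ , c″ , path , inv″ , bmoved′ , untags) =
          moveB-all τ (pre ++ [ e , x , true ]) post (subst (λ L → MoveBInv τ L old′ new′ c′) (sym (++-assoc pre _ post)) inv′)
            (AllP.++⁺ bmoved ((λ _ → refl) ∷ [])) (subst (NewFits τ) (sym (untag-snoc pre post refl)) fits)
    in DT , old″ , new″ , c″ , (edge , os) ∷ path , inv″ , bmoved′ , trans untags (untag-snoc pre post refl)

  moveB-skip τ pre post {a} {old} {new} {c} inv bmoved fits bmoved-a =
    let (DT , old′ , new′ , c′ , path , inv′ , bmoved′ , untags) =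
          moveB-all τ (pre ++ [ a ]) post (subst (λ L → MoveBInv τ L old new c) (sym (++-assoc pre _ post)) inv)
            (AllP.++⁺ bmoved (bmoved-a ∷ [])) (subst (NewFits τ) (cong (map untag) (sym (++-assoc pre _ post))) fits)
    in DT , old′ , new′ , c′ , path , inv′ , bmoved′ , trans untags (cong (map untag) (++-assoc pre _ post))

  all-unmoved : ∀ D → All (λ a → moved a ≡ false) (map tag D)
  all-unmoved []      = []
  all-unmoved (_ ∷ D) = refl ∷ all-unmoved D

  finish-moveY₀ : ∀ τ D₀ {bc c} → MoveY₀Inv τ (map tag D₀) bc c →
    Σ (List Tagged) λ DT → Σ (Counters (suc ny)) λ c′ →
      Path (moveY₀ τ bc) c (moveB τ bc empty) c′ × MoveBInv τ DT bc empty c′ × map untag DT ≡ D₀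
  finish-moveY₀ τ D₀ {bc} inv₀ =
    let (DT , c′ , path , inv , Y₀moved , untags) = moveY₀-all τ [] (map tag D₀) inv₀ [] (all-unmoved D₀)
    in DT , c′ ,
       path ++ᵖ (_∷_ {b = moveB τ bc empty} ((refl , refl , refl , refl , refl) , doZero _ (zeroTest-complete τ inv Y₀moved)) []) ,
       MoveY₀Inv⇒MoveBInv τ inv Y₀moved , trans untags (untag-tag D₀)

  insert-step : ∀ τ new D {c} → CountersOf D c → (unbounded (ins τ) ≡ false → new ! ins τ < ny) →
    Σ Counts λ bc′ → Σ (Counters (suc ny)) λ c′ → Σ Op λ op → InsertEdge τ new bc′ op × OpStep op c c′
  insert-step τ new D ctr room with unbounded (ins τ)
  ... | true  = new , _ , _ , inj₂ (refl , refl , refl) , doIncr _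
  ... | false = let (bc′ , inc) = increment new (ins τ) (room refl) in bc′ , _ , noop , inj₁ (refl , refl , inc) , noop-step D ctr

  unmoved-bounded : ∀ y → unbounded y ≡ false → ∀ {a} → (unbounded (origin a) ≡ false → moved a ≡ true) → unmovedIn y a ≡ false
  unmoved-bounded y by {e , x , m} bmoved-a with x Fin.≟ y
  ... | yes refl rewrite bmoved-a by = refl
  ... | no _     = ∧-zeroʳ (not m)

  finish-moveB : ∀ τ d D₀ {DT old new c} → Capacity (after τ d D₀) → NewFits τ D₀ → MoveBInv τ DT old new c →
    map untag DT ≡ D₀ → Σ Counts λ bc′ → Σ (Counters (suc ny)) λ c′ →
      Path (moveB τ old new) c (idle (tgt (δ τ)) bc′) c′ × IdleInv (after τ d D₀) bc′ c′
  finish-moveB τ d D₀ {DT} cap fits inv₀ refl =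
    let (DT′ , old′ , new′ , c′ , path , inv , bmoved , untags) = moveB-all τ [] DT inv₀ [] fits
        noOld : ∀ y → unbounded y ≡ false → old′ ! y ≡ 0
        noOld y by = trans (proj₁ (proj₂ inv) y by) (count-allFalse (All.map (λ {a} → unmoved-bounded y by {a}) bmoved))
        room : unbounded (ins τ) ≡ false → new′ ! ins τ < ny
        room bi = ≤-trans (≤-reflexive (trans (+-comm 1 _) (cong (λ v → new′ ! ins τ + bit v) (sym (dec-true (ins τ Fin.≟ ins τ) refl)))))
                    (≤-trans (≤-reflexive (news+ins τ d inv bmoved (ins τ) bi))
                      (subst (λ L → size (after τ d L) (ins τ) ≤ ny) (sym untags)
                        (Capacity⇒size≤ny {after τ d (map untag DT)} cap (ins τ) bi)))
        (bc′ , c″ , op , ins-edge , os) = insert-step τ new′ (map (current τ) DT′) (proj₁ inv) room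
    in bc′ , c″ , path ++ᵖ (((refl , refl , noOld , ins-edge) , os) ∷ []) ,
       subst (λ L → IdleInv (after τ d L) bc′ c″) untags (insert-inv τ d inv noOld ins-edge os)

  Capacity⇒NewFits : ∀ τ d D₀ → Capacity (after τ d D₀) → NewFits τ D₀
  Capacity⇒NewFits τ d D₀ cap y by = ≤-trans (≤-reflexive (sym (count-map (inSet y) (relocate τ) D₀)))
    (≤-trans (m≤n+m _ (bit (does (ins τ Fin.≟ y)))) (Capacity⇒size≤ny {after τ d D₀} cap y by))

  simulate-moves : ∀ τ d D₀ {bc c} → Capacity (after τ d D₀) → MoveY₀Inv τ (map tag D₀) bc c →
    Σ Counts λ bc′ → Σ (Counters (suc ny)) λ c′ →
      Path (moveY₀ τ bc) c (idle (tgt (δ τ)) bc′) c′ × IdleInv (after τ d D₀) bc′ c′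
  simulate-moves τ d D₀ cap inv =
    let (DT , c₁ , path₁ , inv₁ , untags) = finish-moveY₀ τ D₀ inv
        (bc′ , c′ , path₂ , inv′) = finish-moveB τ d D₀ cap (Capacity⇒NewFits τ d D₀ cap) inv₁ untags
    in bc′ , c′ , path₁ ++ᵖ path₂ , inv′

  read-step : ∀ τ {D bc c d} → Distinct D → IdleInv D bc c → (∀ x → zv (δ τ) x ≡ sets D x d) →
    Σ Counts λ bc′ → Σ (Counters (suc ny)) λ c′ → Σ Op λ op →
      ReadEdge τ bc bc′ op × OpStep op c c′ × MoveY₀Inv τ (map tag (remove d D)) bc′ c′
  read-step τ {D} {bc} {c} {d} distinct inv zv≐ with Fin.any? (λ y → sets D y d Bool.≟ true)
  ... | no d∉D = bc , c , noop , inj₂ (inj₂ (zv≐0 , refl , refl)) , noop-step D (proj₁ inv) , read-fresh-inv τ inv fresh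
    where
    fresh : Fresh d D
    fresh = All.tabulate λ { {(e , y)} e∈ refl → d∉D (y , ∈-sets e∈) }
    zv≐0 : zv (δ τ) ≐ zeroVec
    zv≐0 x = trans (zv≐ x) (sets-fresh x fresh)
  ... | yes (y , d∈y) with unbounded y in uy
  ...   | true = bc , _ , decr (counter y) , inj₁ (y , zv≐unit , uy , refl , refl) , doDecr (counter y) _ cy ,
                 read-unbounded-inv τ distinct inv d∈ uy cy
    where
    d∈ = sets-∈ d∈y
    zv≐unit : zv (δ τ) ≐ unitVec y
    zv≐unit x = trans (zv≐ x) (sym (unitVec-sets distinct d∈ x))
    cy : c (counter y) ≡ suc (load (remove d D) (counter y))
    cy = trans (proj₁ inv (counter y)) (trans (count-remove (onCounter (counter y)) distinct d∈)
                                          (cong (λ b → bit b + load (remove d D) (counter y)) (onCounter-self d uy)))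
  ...   | false = bc′ , c , noop , inj₂ (inj₁ (y , zv≐unit , uy , inc , refl)) , noop-step D (proj₁ inv) ,
                  read-bounded-inv τ distinct inv d∈ uy inc
    where
    d∈ = sets-∈ d∈y
    zv≐unit : zv (δ τ) ≐ unitVec y
    zv≐unit x = trans (zv≐ x) (sym (unitVec-sets distinct d∈ x))
    bc-dec = decrement bc y (subst (1 ≤_) (sym (proj₂ inv y uy)) (count-∈ (inSet y) d∈ (dec-true (y Fin.≟ y) refl)))
    bc′ = proj₁ bc-dec
    inc = proj₂ bc-dec

  drain-run : ∀ q D {c} → CountersOf D c → All (λ (_ , y) → unbounded y ≡ true → unitInC y) D → Run (final q) c []
  drain-run q [] ctr [] = done refl ctr
  drain-run q ((e , y) ∷ D) {c} ctr (y∈C ∷ rest) with unbounded y in uy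
  ... | false = drain-run q D ctr rest
  ... | true  = stepε {b = final q} (refl , refl , y , uy , y∈C refl , refl) (doDecr (counter y) _ cy) (drain-run q D ctr′ rest)
    where
    cy : c (counter y) ≡ suc (load D (counter y))
    cy = trans (ctr (counter y)) (cong (λ b → bit b + load D (counter y)) (dec-true (counter y Fin.≟ counter y) refl))
    ctr′ : CountersOf D (updateAt c (counter y) (λ _ → load D (counter y)))
    ctr′ i = +-cancelʳ-≡ (bit (does (counter y Fin.≟ i))) _ _
               (trans (updateAt-pred c (counter y) i cy) (trans (ctr i) (+-comm _ (load D i))))

  mutual
    complete-idle : ∀ {q bc c D X dw} → Distinct D → IdleInv D bc c → Capacity D → X ≈ sets D →
      AccRun A (q , X) dw → Run (idle q bc) c (str dw)
    complete-idle {q} {bc} {D = D} distinct inv _ X≈ (done (q∈F , accepting)) =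
      stepε {b = final q} (refl , refl , q∈F , refl , bounded-ok) (noop-step D (proj₁ inv))
        (drain-run q D (proj₁ inv) (All.tabulate λ e∈ _ → in-C e∈))
      where
      in-C : ∀ {e y} → (e , y) ∈ D → unitInC y
      in-C {e} {y} e∈ = let (c₀ , c₀∈C , c₀≐) = accepting e (y , trans (X≈ y e) (∈-sets e∈))
                        in c₀ , c₀∈C , λ z → trans (c₀≐ z) (trans (X≈ z e) (sym (unitVec-sets distinct e∈ z)))
      bounded-ok : ∀ y → unbounded y ≡ false → 1 ≤ bc ! y → unitInC y
      bounded-ok y by 1≤ = in-C (proj₂ (find-in-set D (subst (1 ≤_) (proj₂ inv y by) 1≤)))
    complete-idle distinct inv cap X≈ (step t t∈Δ applicable run) =
      complete-step (Any.index t∈Δ) (sym (lookup-index t∈Δ)) distinct inv cap X≈ applicable run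

    complete-step : ∀ τ {t q bc c D X a d dw} → δ τ ≡ t → Distinct D → IdleInv D bc c → Capacity D → X ≈ sets D →
      Applicable A t (q , X) (a , d) → AccRun A (applyTr A t (q , X) d) dw → Run (idle q bc) c (a ∷ str dw)
    complete-step τ {q = q} {D = D} {X} {d = d} refl distinct inv cap X≈ (src≡ , refl , zv≐) run =
      let (bc₁ , c₁ , op , read , os , inv₁) = read-step τ distinct inv zv≐′
          (bc′ , c′ , path , inv′) = simulate-moves τ d (remove d D) cap′ inv₁
      in stepa {b = moveY₀ τ bc₁} (refl , src≡ , read) os
           (Path-Run path (complete-idle (after-Distinct τ (remove-fresh d D) (remove-Distinct d distinct)) inv′ cap′ X≈′ run))
      where
      zv≐′ : ∀ x → zv (δ τ) x ≡ sets D x d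
      zv≐′ x = trans (zv≐ x) (X≈ x d)
      cap′ : Capacity (after τ d (remove d D))
      cap′ = Capacity-after τ d {remove d D} (Capacity-remove d {D} cap)
      X≈′ : proj₂ (applyTr A (δ τ) (q , X) d) ≈ sets (after τ d (remove d D))
      X≈′ y e = trans (applyTr-cong (δ τ) q d X≈ y e) (Read.applyTr-sets τ distinct zv≐′ q y e)

  initial-inv : IdleInv [] empty (λ _ → 0)
  initial-inv = (λ _ → refl) , (λ y _ → empty-! y)

  initial-state : ∀ a → isInitial a ≡ true → Σ (Fin nq) λ q → I q ≡ true × a ≡ idle q empty
  initial-state (idle q bc) h = q , ∧-conicalˡ _ _ h , cong (idle q) (from-does (bc ≟ᶜ empty) (∧-conicalʳ _ _ h))

  sound : ∀ w → InLMC M w → Σ (DataWord s) λ dw → InL A dw × str dw ≡ w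
  sound w (i , i∈J , run) with initial-state ⌞ i ⌟ i∈J
  ... | q , q∈I , ⌞i⌟≡ =
    let (dw , accRun , str≡) = sound-idle [] initial-inv (subst (λ a → Run a _ w) ⌞i⌟≡ (MCAccRun⇒Run run))
    in dw , (q , q∈I , AccRun-cong (λ y _ → sets-fresh y []) accRun) , str≡

  complete : ∀ w → (Σ (DataWord s) λ dw → InL A dw × str dw ≡ w) → InLMC M w
  complete w (dw , (q , q∈I , accRun) , refl) =
    ⌜ idle q empty ⌝ , trans (cong isInitial (⌞⌜⌝⌟ (idle q empty))) (∧-true q∈I (dec-true (empty ≟ᶜ empty) refl)) ,
    Run⇒MCAccRun (complete-idle [] initial-inv (λ _ → z≤n) (λ y _ → sym (sets-fresh y [])) accRun)

proposition18 : (s : ℕ) (A : SetAutomaton s) → Normal A → Ordered A →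
    Σ (MulticounterAutomaton s) λ M →
      (w : List (Fin s)) →
        (InLMC M w → Σ (DataWord s) λ dw → InL A dw × str dw ≡ w)
        × ((Σ (DataWord s) λ dw → InL A dw × str dw ≡ w) → InLMC M w)
proposition18 s A normal ordered = M , λ w → sound w , complete w
  where open Simulation A normal ordered
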